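{- Let $m,n\ge 2$ and $t\ge 3$. Let $G$ be a graph of order $2m$ that admits a local antimagic $t$-coloring $f$. Suppose that (i) the $t$ color classes of $f$ can be split into two groups whose unions $V_1$ and $V_2$ satisfy $|V_1|=|V_2|=m$; (ii) there are no integers $a,b$ such that $a$ and $b+1$ are induced colors (values of $f^+$) of vertices in $V_1$ while $a+1$ and $b$ are induced colors of vertices in $V_2$; and (iii) $2n-1>2m$, or else $m\ge n^2-\frac{3(n-1)}{2}$. Then $\chi_{la}(G\vee O_{2n-1})\le t+1$, with equality if $\chi(G)=t$.
   Context: For a simple graph with $q$ edges, a bijection $f:E\to\{1,\dots,q\}$ is a local antimagic labeling if $f^+(u)\neq f^+(v)$ for every edge $uv$, where $f^+(u)=\sum_{e\ni u} f(e)$; the value $f^+(u)$ is the induced color of $u$, and if exactly $t$ distinct colors occur $f$ is a local antimagic $t$-coloring; a color class is the set of vertices with a given induced color. $\chi_{la}$ is the minimum number of distinct induced colors over all local antimagic labelings; $\chi$ is the chromatic number. $O_n$ is the edgeless graph on $n$ vertices, and the join $G\vee H$ of vertex-disjoint graphs has vertex set $V(G)\cup V(H)$ and edge set $E(G)\cup E(H)\cup\{uv:u\in V(G),v\in V(H)\}$. -}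

module Defs where

open import Data.Nat using (ℕ; zero; suc; _+_; _*_; _≤_; _<_)
open import Data.Bool using (Bool; true; false; if_then_else_; not)
open import Data.Fin using (Fin; splitAt)
open import Data.List using (List; map; allFin)
open import Data.Nat.ListAction using (sum)
open import Data.Sum using (_⊎_; inj₁; inj₂)
open import Data.Product using (Σ; _×_; _,_; ∃; ∃-syntax)
open import Relation.Binary.PropositionalEquality using (_≡_; _≢_; refl)

record Graph : Set where
  field
    order  : ℕ
    adj    : Fin order → Fin order → Bool
    sym    : ∀ u v → adj u v ≡ adj v u
    irrefl : ∀ u → adj u u ≡ false
open Graph public

Edge : (G : Graph) → Fin (order G) → Fin (order G) → Set
Edge G u v = adj G u v ≡ true

ΣV : ∀ {p} → (Fin p → ℕ) → ℕ
ΣV {p} g = sum (map g (allFin p))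

countV : ∀ {p} → (Fin p → Bool) → ℕ
countV P = ΣV (λ u → if P u then 1 else 0)

-- An edge labeling is given as a function on ordered pairs of vertices,
-- required to be symmetric on edges (so it is a function on E).
fplus : (G : Graph) → (Fin (order G) → Fin (order G) → ℕ) → Fin (order G) → ℕ
fplus G f u = ΣV (λ v → if adj G u v then f u v else 0)

-- f restricted to E is a bijection E → {1,…,q} for some q
-- (q is then necessarily |E|).
IsEdgeBijection : (G : Graph) → (Fin (order G) → Fin (order G) → ℕ) → Set
IsEdgeBijection G f =
  (∀ u v → Edge G u v → f u v ≡ f v u)
  × Σ ℕ (λ q →
      (∀ u v → Edge G u v → (1 ≤ f u v) × (f u v ≤ q))
    × (∀ k → 1 ≤ k → k ≤ q → ∃[ u ] ∃[ v ] (Edge G u v × f u v ≡ k))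
    × (∀ u v x y → Edge G u v → Edge G x y → f u v ≡ f x y →
         ((u ≡ x) × (v ≡ y)) ⊎ ((u ≡ y) × (v ≡ x))))

IsLocalAntimagic : (G : Graph) → (Fin (order G) → Fin (order G) → ℕ) → Set
IsLocalAntimagic G f =
  IsEdgeBijection G f × (∀ u v → Edge G u v → fplus G f u ≢ fplus G f v)

NumValues : ∀ {p} → (Fin p → ℕ) → ℕ → Set
NumValues {p} c t =
  Σ (Fin t → ℕ) λ col →
    (∀ i j → col i ≡ col j → i ≡ j)
    × (∀ u → ∃[ i ] c u ≡ col i)
    × (∀ i → ∃[ u ] c u ≡ col i)

IsLocalAntimagicColoring : (G : Graph) → (Fin (order G) → Fin (order G) → ℕ) → ℕ → Set
IsLocalAntimagicColoring G f t = IsLocalAntimagic G f × NumValues (fplus G f) t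

χla≤ : Graph → ℕ → Set
χla≤ G k = ∃[ f ] ∃[ s ] (IsLocalAntimagicColoring G f s × s ≤ k)

χla≡ : Graph → ℕ → Set
χla≡ G k = ∃[ f ] IsLocalAntimagicColoring G f k
         × (∀ f s → IsLocalAntimagicColoring G f s → k ≤ s)

ProperColoring : (G : Graph) → (s : ℕ) → (Fin (order G) → Fin s) → Set
ProperColoring G s c = ∀ u v → Edge G u v → c u ≢ c v

χ≡ : Graph → ℕ → Set
χ≡ G k = (∃[ c ] ProperColoring G k c)
       × (∀ s c → ProperColoring G s c → k ≤ s)

-- join G ∨ O_k : vertices of G come first (Fin p), then the k new vertices
joinAdj : ∀ {p k} → (Fin p → Fin p → Bool) → Fin p ⊎ Fin k → Fin p ⊎ Fin k → Bool
joinAdj a (inj₁ i) (inj₁ j) = a i j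
joinAdj a (inj₁ i) (inj₂ j) = true
joinAdj a (inj₂ i) (inj₁ j) = true
joinAdj a (inj₂ i) (inj₂ j) = false

joinAdj-sym : ∀ {p k} (a : Fin p → Fin p → Bool) → (∀ u v → a u v ≡ a v u) →
              (x y : Fin p ⊎ Fin k) → joinAdj a x y ≡ joinAdj a y x
joinAdj-sym a s (inj₁ i) (inj₁ j) = s i j
joinAdj-sym a s (inj₁ i) (inj₂ j) = refl
joinAdj-sym a s (inj₂ i) (inj₁ j) = refl
joinAdj-sym a s (inj₂ i) (inj₂ j) = refl

joinAdj-irr : ∀ {p k} (a : Fin p → Fin p → Bool) → (∀ u → a u u ≡ false) →
              (x : Fin p ⊎ Fin k) → joinAdj a x x ≡ false
joinAdj-irr a r (inj₁ i) = r i
joinAdj-irr a r (inj₂ i) = refl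

joinEmpty : Graph → ℕ → Graph
joinEmpty G k = record
  { order  = order G + k
  ; adj    = λ x y → joinAdj (adj G) (splitAt (order G) x) (splitAt (order G) y)
  ; sym    = λ x y → joinAdj-sym (adj G) (sym G) (splitAt (order G) x) (splitAt (order G) y)
  ; irrefl = λ x → joinAdj-irr (adj G) (irrefl G) (splitAt (order G) x)
  }

{-# OPTIONS --safe #-}
-- The labelling of G ∨ O_K, K = 2n - 1, keeps f on G and labels the edge from the vertex of rank r on
-- side s of the split to the c-th outer vertex by q + A s r c, where A is a 2m × K array whose entries
-- are 1, …, 2mK, whose columns have equal sums N and whose rows sum to S or S + 1 according to the side.
-- Every outer vertex then gets the colour 2mq + N and a vertex u of G gets f⁺(u) + Kq + S, plus 1 on
-- the second side. By (ii) the sides can be ordered so that this shift never merges the colours of two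
-- adjacent vertices, and (iii) keeps 2mq + N apart from the inner colours, so t + 1 colours suffice.
-- Conversely the outer colour is missing on G, where the colours form a proper colouring.
-- The array is written down for K = 3 (separately for m even and odd) and widened two columns at a time.

module Submission where

open import Defs hiding (sym)
open import Data.Nat
open import Data.Nat.Properties
open import Data.Nat.Tactic.RingSolver
open import Data.Bool using (Bool; true; false; if_then_else_; not; T)
import Data.Bool as Bool
open import Data.Bool.Properties using (T-≡; not-involutive)
open import Data.Fin using (Fin; zero; suc; toℕ; fromℕ<; _↑ˡ_; _↑ʳ_; splitAt; join; punchIn; punchOut)
import Data.Fin.Properties as Fin
open import Data.List using (tabulate; _∷_; [])
open import Data.List.Properties using (map-tabulate)
import Data.Nat.ListAction as List
open import Algebra.Properties.Semiring.Sum +-*-semiring using (sum; sum-cong-≗; ∑-distrib-+; *-distribˡ-sum; sum-remove)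
open import Data.Product using (Σ; _×_; _,_; proj₁; proj₂; ∃-syntax)
open import Data.Product.Properties using (,-injectiveˡ; ,-injectiveʳ)
open import Data.Sum using (_⊎_; inj₁; inj₂)
open import Data.Empty using (⊥-elim)
open import Function using (_∘_; id; Equivalence)
open import Relation.Nullary using (¬_; yes; no; does; _×-dec_)
open import Relation.Binary.PropositionalEquality
open import Relation.Binary.Definitions using (tri<; tri≈; tri>)


list-sum-tabulate : ∀ {p} (g : Fin p → ℕ) → List.sum (tabulate g) ≡ sum g
list-sum-tabulate {zero} g = refl
list-sum-tabulate {suc p} g = cong (g zero +_) (list-sum-tabulate (g ∘ suc))

ΣV≡sum : ∀ {p} (g : Fin p → ℕ) → ΣV g ≡ sum g
ΣV≡sum {p} g = trans (cong List.sum (map-tabulate id g)) (list-sum-tabulate g)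

sum-const : ∀ {p} (c : ℕ) → sum {p} (λ _ → c) ≡ p * c
sum-const {zero} c = refl
sum-const {suc p} c = cong (c +_) (sum-const {p} c)

sum-↑ : ∀ a b (g : Fin (a + b) → ℕ) → sum g ≡ sum (λ i → g (i ↑ˡ b)) + sum (λ j → g (a ↑ʳ j))
sum-↑ zero b g = refl
sum-↑ (suc a) b g = trans (cong (g zero +_) (sum-↑ a b (g ∘ suc))) (sym (+-assoc (g zero) _ _))

sum-update : ∀ {p} (i : Fin p) (g h : Fin p → ℕ) → (∀ j → j ≢ i → g j ≡ h j) →
             sum g + h i ≡ sum h + g i
sum-update {suc p} i g h agree = begin
    sum g + h i                                       ≡⟨ cong (_+ h i) (sum-remove {i = i} g) ⟩
    g i + sum (g ∘ punchIn i) + h i                   ≡⟨ cong (λ x → g i + x + h i) (sum-cong-≗ off-i) ⟩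
    g i + sum (h ∘ punchIn i) + h i                   ≡⟨ swap-ends (g i) _ (h i) ⟩
    h i + sum (h ∘ punchIn i) + g i                   ≡⟨ cong (_+ g i) (sym (sum-remove {i = i} h)) ⟩
    sum h + g i                                       ∎
  where
  open ≡-Reasoning
  off-i : ∀ j → g (punchIn i j) ≡ h (punchIn i j)
  off-i j = agree (punchIn i j) (Fin.punchInᵢ≢i i j)
  swap-ends : ∀ a b c → a + b + c ≡ c + b + a
  swap-ends = solve-∀


sumBelow : ℕ → (ℕ → ℕ) → ℕ
sumBelow n h = sum {n} (h ∘ toℕ)

sumBelow-cong : ∀ n {g h : ℕ → ℕ} → (∀ i → i < n → g i ≡ h i) → sumBelow n g ≡ sumBelow n h
sumBelow-cong n eq = sum-cong-≗ (λ i → eq (toℕ i) (Fin.toℕ<n i))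

sumBelow-+ : ∀ n (g h : ℕ → ℕ) → sumBelow n (λ i → g i + h i) ≡ sumBelow n g + sumBelow n h
sumBelow-+ n g h = ∑-distrib-+ {n} (g ∘ toℕ) (h ∘ toℕ)

sumBelow-* : ∀ n c (h : ℕ → ℕ) → sumBelow n (λ i → c * h i) ≡ c * sumBelow n h
sumBelow-* n c h = sym (*-distribˡ-sum {n} c (h ∘ toℕ))

sumBelow-const : ∀ n c → sumBelow n (λ _ → c) ≡ n * c
sumBelow-const n c = sum-const {n} c

sumBelow-split : ∀ a b (h : ℕ → ℕ) → sumBelow (a + b) h ≡ sumBelow a h + sumBelow b (λ i → h (a + i))
sumBelow-split zero b h = refl
sumBelow-split (suc a) b h = trans (cong (h 0 +_) (sumBelow-split a b (h ∘ suc))) (sym (+-assoc (h 0) _ _))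

tri : ℕ → ℕ
tri n = sumBelow n id

sumBelow-shift : ∀ n a → sumBelow n (λ i → a + i) ≡ n * a + tri n
sumBelow-shift n a = trans (sumBelow-+ n (λ _ → a) id) (cong (_+ tri n) (sumBelow-const n a))

tri-suc : ∀ n → tri (suc n) ≡ n + tri n
tri-suc n = trans (sumBelow-shift n 1) (cong (_+ tri n) (*-identityʳ n))

2*tri+n≡n*n : ∀ n → 2 * tri n + n ≡ n * n
2*tri+n≡n*n zero = refl
2*tri+n≡n*n (suc n) = begin
    2 * tri (suc n) + suc n         ≡⟨ cong (λ x → 2 * x + suc n) (tri-suc n) ⟩
    2 * (n + tri n) + suc n         ≡⟨ regroup n (tri n) ⟩
    (2 * tri n + n) + (1 + 2 * n)   ≡⟨ cong (_+ (1 + 2 * n)) (2*tri+n≡n*n n) ⟩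
    n * n + (1 + 2 * n)             ≡⟨ square-suc n ⟩
    suc n * suc n                   ∎
  where
  open ≡-Reasoning
  regroup : ∀ n t → 2 * (n + t) + suc n ≡ (2 * t + n) + (1 + 2 * n)
  regroup = solve-∀
  square-suc : ∀ n → n * n + (1 + 2 * n) ≡ suc n * suc n
  square-suc = solve-∀

sumBelow-reverse : ∀ n → sumBelow n (λ i → n ∸ suc i) ≡ tri n
sumBelow-reverse zero = refl
sumBelow-reverse (suc n) = trans (cong (n +_) (sumBelow-reverse n)) (sym (tri-suc n))

tri-+ : ∀ c d → tri (c + d) ≡ tri c + (d * c + tri d)
tri-+ c d = trans (sumBelow-split c d id) (cong (tri c +_) (sumBelow-shift d c))

tri≤n*n : ∀ n → tri n ≤ n * n
tri≤n*n n = subst (tri n ≤_) (trans (regroup (tri n) n) (2*tri+n≡n*n n)) (m≤m+n (tri n) (tri n + n))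
  where
  regroup : ∀ t n → t + (t + n) ≡ 2 * t + n
  regroup = solve-∀

tri-mono-≤ : ∀ {a b} → a ≤ b → tri a ≤ tri b
tri-mono-≤ {zero} _ = z≤n
tri-mono-≤ {suc a} {suc b} (s≤s a≤b) =
  subst₂ _≤_ (sym (tri-suc a)) (sym (tri-suc b)) (+-mono-≤ a≤b (tri-mono-≤ a≤b))

tri+<tri-suc : ∀ {a b} → a < b → tri b + a < tri (suc b)
tri+<tri-suc {a} {b} a<b =
  subst (tri b + a <_) (trans (+-comm (tri b) b) (sym (tri-suc b))) (+-monoʳ-< (tri b) a<b)

tri+-injective : ∀ {a b a' b'} → a < b → a' < b' → tri b + a ≡ tri b' + a' → b ≡ b' × a ≡ a'
tri+-injective {a} {b} {a'} {b'} a<b a'<b' eq with <-cmp b b'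
... | tri< b<b' _ _ = ⊥-elim (<-irrefl eq
        (<-≤-trans (tri+<tri-suc a<b) (≤-trans (tri-mono-≤ b<b') (m≤m+n (tri b') a'))))
... | tri> _ _ b'<b = ⊥-elim (<-irrefl (sym eq)
        (<-≤-trans (tri+<tri-suc a'<b') (≤-trans (tri-mono-≤ b'<b) (m≤m+n (tri b) a))))
... | tri≈ _ refl _ = refl , +-cancelˡ-≡ (tri b) a a' eq


𝟙 : Bool → ℕ
𝟙 b = if b then 1 else 0

count : ∀ {p} → (Fin p → Bool) → ℕ
count P = sum (𝟙 ∘ P)

countV≡count : ∀ {p} (P : Fin p → Bool) → countV P ≡ count P
countV≡count P = ΣV≡sum (𝟙 ∘ P)

rank : ∀ {p} → (Fin p → Bool) → Fin p → ℕ
rank {suc p} P zero = 0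
rank {suc p} P (suc u) = 𝟙 (P zero) + rank (P ∘ suc) u

rank<count : ∀ {p} (P : Fin p → Bool) u → P u ≡ true → rank P u < count P
rank<count {suc p} P zero Pu rewrite Pu = s≤s z≤n
rank<count {suc p} P (suc u) Pu with P zero
... | true = s≤s (rank<count (P ∘ suc) u Pu)
... | false = rank<count (P ∘ suc) u Pu

rank-injective : ∀ {p} (P : Fin p → Bool) u v → P u ≡ true → P v ≡ true → rank P u ≡ rank P v → u ≡ v
rank-injective {suc p} P zero zero Pu Pv eq = refl
rank-injective {suc p} P zero (suc v) Pu Pv eq rewrite Pu with () ← eq
rank-injective {suc p} P (suc u) zero Pu Pv eq rewrite Pv with () ← eq
rank-injective {suc p} P (suc u) (suc v) Pu Pv eq with P zero
... | true = cong suc (rank-injective (P ∘ suc) u v Pu Pv (suc-injective eq))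
... | false = cong suc (rank-injective (P ∘ suc) u v Pu Pv eq)

rank-surjective : ∀ {p} (P : Fin p → Bool) r → r < count P → Σ (Fin p) λ u → P u ≡ true × rank P u ≡ r
rank-surjective {suc p} P r r< with P zero in P0
rank-surjective {suc p} P zero r< | true = zero , P0 , refl
rank-surjective {suc p} P (suc r) (s≤s r<) | true with rank-surjective (P ∘ suc) r r<
... | u , Pu , ru = suc u , Pu , trans (cong (λ b → 𝟙 b + rank (P ∘ suc) u) P0) (cong suc ru)
rank-surjective {suc p} P r r< | false with rank-surjective (P ∘ suc) r r<
... | u , Pu , ru = suc u , Pu , trans (cong (λ b → 𝟙 b + rank (P ∘ suc) u) P0) ru

sum-by-rank : ∀ {p} (P : Fin p → Bool) (h : ℕ → ℕ) →
  sum (λ u → if P u then h (rank P u) else 0) ≡ sumBelow (count P) h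
sum-by-rank {zero} P h = refl
sum-by-rank {suc p} P h with P zero
... | true = cong (h 0 +_) (sum-by-rank (P ∘ suc) (h ∘ suc))
... | false = sum-by-rank (P ∘ suc) h

erase : ∀ {p} → Fin p → (Fin p → Bool) → Fin p → Bool
erase u P v = if does (v Fin.≟ u) then false else P v

erase-≢ : ∀ {p} {u v : Fin p} P → v ≢ u → erase u P v ≡ P v
erase-≢ {u = u} {v} P v≢u with v Fin.≟ u
... | yes v≡u = ⊥-elim (v≢u v≡u)
... | no _ = refl

erase-≡ : ∀ {p} (u : Fin p) P → erase u P u ≡ false
erase-≡ u P with u Fin.≟ u
... | yes _ = refl
... | no u≢u = ⊥-elim (u≢u refl)

sum-erase : ∀ {p} (u : Fin p) (P : Fin p → Bool) (h : Fin p → ℕ) → P u ≡ true →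
  sum (λ v → if P v then h v else 0) ≡ sum (λ v → if erase u P v then h v else 0) + h u
sum-erase {p} u P h Pu = begin
    sum H                     ≡⟨ sym (+-identityʳ (sum H)) ⟩
    sum H + 0                 ≡⟨ cong (λ b → sum H + (if b then h u else 0)) (sym (erase-≡ u P)) ⟩
    sum H + H′ u              ≡⟨ sum-update u H H′ (λ v v≢u → cong (λ b → if b then h v else 0) (sym (erase-≢ P v≢u))) ⟩
    sum H′ + H u              ≡⟨ cong (λ b → sum H′ + (if b then h u else 0)) Pu ⟩
    sum H′ + h u              ∎
  where
  open ≡-Reasoning
  H H′ : Fin p → ℕ
  H v = if P v then h v else 0
  H′ v = if erase u P v then h v else 0

count-erase : ∀ {p} (u : Fin p) (P : Fin p → Bool) → P u ≡ true → count P ≡ suc (count (erase u P))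
count-erase u P Pu = trans (sum-erase u P (λ _ → 1) Pu) (+-comm _ 1)

count+count-not : ∀ {p} (P : Fin p → Bool) → count P + count (not ∘ P) ≡ p
count+count-not {p} P = begin
    count P + count (not ∘ P)          ≡⟨ sym (∑-distrib-+ {p} (𝟙 ∘ P) (𝟙 ∘ not ∘ P)) ⟩
    sum (λ v → 𝟙 (P v) + 𝟙 (not (P v))) ≡⟨ sum-cong-≗ (λ v → 𝟙+𝟙-not (P v)) ⟩
    sum {p} (λ _ → 1)                   ≡⟨ trans (sum-const {p} 1) (*-identityʳ p) ⟩
    p                                   ∎
  where
  open ≡-Reasoning
  𝟙+𝟙-not : ∀ b → 𝟙 b + 𝟙 (not b) ≡ 1
  𝟙+𝟙-not true = refl
  𝟙+𝟙-not false = refl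

count<size : ∀ {p} (P : Fin p → Bool) u → P u ≡ false → count P < p
count<size {p} P u Pu = subst (count P <_) (count+count-not P)
  (subst (λ c → count P < count P + c) (sym (count-erase u (not ∘ P) (cong not Pu)))
    (m<m+n (count P) z<s))

sum-if-false : ∀ {p} (P : Fin p → Bool) (g : Fin p → ℕ) → (∀ v → P v ≡ false) →
               sum (λ v → if P v then g v else 0) ≡ 0
sum-if-false {p} P g none =
  trans (sum-cong-≗ (λ v → cong (λ b → if b then g v else 0) (none v))) (trans (sum-const {p} 0) (*-zeroʳ p))

-- k distinct values in [1, q] sum to at most q + (q - 1) + ⋯ + (q - k + 1) = k q - tri k.
sum-distinct+tri≤ : ∀ q {p} (P : Fin p → Bool) (h : Fin p → ℕ) →
  (∀ v → P v ≡ true → 1 ≤ h v × h v ≤ q) →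
  (∀ v w → P v ≡ true → P w ≡ true → h v ≡ h w → v ≡ w) →
  sum (λ v → if P v then h v else 0) + tri (count P) ≤ count P * q
sum-distinct+tri≤ zero {p} P h bounds inj = ≤-reflexive (begin
    sum (λ v → if P v then h v else 0) + tri (count P)  ≡⟨ cong₂ (λ x y → x + tri y) (sum-if-false P h P-empty)
                                                                                     (sum-if-false P (λ _ → 1) P-empty) ⟩
    0                                                    ≡⟨ sym (*-zeroʳ (count P)) ⟩
    count P * 0                                          ∎)
  where
  open ≡-Reasoning
  P-empty : ∀ v → P v ≡ false
  P-empty v with P v in Pv
  ... | true with () ← ≤-trans (proj₁ (bounds v Pv)) (proj₂ (bounds v Pv))
  ... | false = refl
sum-distinct+tri≤ (suc q) {p} P h bounds inj with Fin.any? (λ v → (P v Bool.≟ true) ×-dec (h v ≟ suc q))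
... | no no-top = ≤-trans (sum-distinct+tri≤ q P h bounds′ inj) (*-monoʳ-≤ (count P) (n≤1+n q))
  where
  bounds′ : ∀ v → P v ≡ true → 1 ≤ h v × h v ≤ q
  bounds′ v Pv = proj₁ (bounds v Pv) , ≤-pred (≤∧≢⇒< (proj₂ (bounds v Pv)) (λ eq → no-top (v , Pv , eq)))
... | yes (top , Ptop , htop) = begin
    sum H + tri (count P)                    ≡⟨ cong₂ (λ x c → x + tri c) (sum-erase top P h Ptop) (count-erase top P Ptop) ⟩
    sum H′ + h top + tri (suc c′)            ≡⟨ cong (λ x → sum H′ + x + tri (suc c′)) htop ⟩
    sum H′ + suc q + tri (suc c′)            ≡⟨ cong (sum H′ + suc q +_) (tri-suc c′) ⟩
    sum H′ + suc q + (c′ + tri c′)           ≡⟨ regroup (sum H′) q c′ (tri c′) ⟩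
    (sum H′ + tri c′) + (suc q + c′)         ≤⟨ +-monoˡ-≤ (suc q + c′) (sum-distinct+tri≤ q P′ h bounds′ inj′) ⟩
    c′ * q + (suc q + c′)                    ≡⟨ expand c′ q ⟩
    suc c′ * suc q                           ≡⟨ cong (_* suc q) (sym (count-erase top P Ptop)) ⟩
    count P * suc q                          ∎
  where
  open ≤-Reasoning
  P′ : Fin p → Bool
  P′ = erase top P
  c′ : ℕ
  c′ = count P′
  H H′ : Fin p → ℕ
  H v = if P v then h v else 0
  H′ v = if P′ v then h v else 0
  bounds′ : ∀ v → P′ v ≡ true → 1 ≤ h v × h v ≤ q
  bounds′ v P′v with v Fin.≟ top
  ... | yes _ with () ← P′v
  ... | no v≢top = proj₁ (bounds v P′v) ,
        ≤-pred (≤∧≢⇒< (proj₂ (bounds v P′v)) (λ eq → v≢top (inj v top P′v Ptop (trans eq (sym htop)))))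
  inj′ : ∀ v w → P′ v ≡ true → P′ w ≡ true → h v ≡ h w → v ≡ w
  inj′ v w P′v P′w with v Fin.≟ top | w Fin.≟ top
  ... | yes _ | _ with () ← P′v
  ... | no _ | yes _ with () ← P′w
  ... | no _ | no _ = inj v w P′v P′w
  regroup : ∀ a q c t → a + suc q + (c + t) ≡ (a + t) + (suc q + c)
  regroup = solve-∀
  expand : ∀ c q → c * q + (suc q + c) ≡ suc c * suc q
  expand = solve-∀

module _ (G : Graph) where

  degree : Fin (order G) → ℕ
  degree u = count (adj G u)

  degree<order : ∀ u → degree u < order G
  degree<order u = count<size (adj G u) u (irrefl G u)

  fplus+tri≤ : ∀ {q} (f : Fin (order G) → Fin (order G) → ℕ) → (∀ u v → Edge G u v → (1 ≤ f u v) × (f u v ≤ q)) →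
    (∀ u v x y → Edge G u v → Edge G x y → f u v ≡ f x y → ((u ≡ x) × (v ≡ y)) ⊎ ((u ≡ y) × (v ≡ x))) →
    ∀ u → fplus G f u + tri (degree u) ≤ degree u * q
  fplus+tri≤ {q} f bounds inj u = subst (λ x → x + tri (degree u) ≤ degree u * q)
    (sym (ΣV≡sum (λ v → if adj G u v then f u v else 0)))
    (sum-distinct+tri≤ q (adj G u) (f u) (λ v → bounds u v) inj-at-u)
    where
    inj-at-u : ∀ v w → Edge G u v → Edge G u w → f u v ≡ f u w → v ≡ w
    inj-at-u v w uv uw eq with inj u v u w uv uw eq
    ... | inj₁ (_ , v≡w) = v≡w
    ... | inj₂ (_ , refl) with () ← trans (sym uv) (irrefl G u)

  -- Label k is carried by an edge a < b, and k ↦ tri b + a is an injection into [0, tri (order G)).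
  labels≤tri : ∀ {q} (f : Fin (order G) → Fin (order G) → ℕ) → (∀ u v → Edge G u v → f u v ≡ f v u) →
    (∀ k → 1 ≤ k → k ≤ q → ∃[ u ] ∃[ v ] (Edge G u v × f u v ≡ k)) →
    q ≤ tri (order G)
  labels≤tri {q} f f-sym surj = Fin.injective⇒≤ {f = λ i → fromℕ< (code<tri i)} λ {i} {j} same-code →
    code-injective i j (trans (sym (Fin.toℕ-fromℕ< (code<tri i))) (trans (cong toℕ same-code) (Fin.toℕ-fromℕ< (code<tri j))))
    where
    OrientedEdge : ℕ → Set
    OrientedEdge k = Σ (Fin (order G)) λ a → Σ (Fin (order G)) λ b → toℕ a < toℕ b × f a b ≡ k

    orient : ∀ {k} u v → Edge G u v → f u v ≡ k → OrientedEdge k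
    orient u v uv fk with <-cmp (toℕ u) (toℕ v)
    ... | tri< u<v _ _ = u , v , u<v , fk
    ... | tri> _ _ v<u = v , u , v<u , trans (sym (f-sym u v uv)) fk
    ... | tri≈ _ u≡v _ with Fin.toℕ-injective u≡v
    ...   | refl with () ← trans (sym uv) (irrefl G u)

    edge : (i : Fin q) → OrientedEdge (suc (toℕ i))
    edge i with surj (suc (toℕ i)) (s≤s z≤n) (Fin.toℕ<n i)
    ... | u , v , uv , fk = orient u v uv fk

    code : Fin q → ℕ
    code i = tri (toℕ (proj₁ (proj₂ (edge i)))) + toℕ (proj₁ (edge i))

    code<tri : ∀ i → code i < tri (order G)
    code<tri i = <-≤-trans (tri+<tri-suc (proj₁ (proj₂ (proj₂ (edge i)))))
                           (tri-mono-≤ (Fin.toℕ<n (proj₁ (proj₂ (edge i)))))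

    code-injective : ∀ i j → code i ≡ code j → i ≡ j
    code-injective i j eq with tri+-injective (proj₁ (proj₂ (proj₂ (edge i)))) (proj₁ (proj₂ (proj₂ (edge j)))) eq
    ... | b≡ , a≡ = Fin.toℕ-injective (suc-injective (trans (sym (proj₂ (proj₂ (proj₂ (edge i)))))
          (trans (cong₂ f (Fin.toℕ-injective a≡) (Fin.toℕ-injective b≡)) (proj₂ (proj₂ (proj₂ (edge j)))))))

columnSum : ℕ → ℕ → ℕ
columnSum m W = m * suc (2 * (m * W))

rowSum : ℕ → ℕ → ℕ → ℕ
rowSum m k W = k * suc (2 * (m * W)) + m * W

-- The second alternative of condition (iii), m ≥ n² - 3 (n - 1) / 2, doubled to stay in ℕ.
LargeOrder : ℕ → ℕ → Set
LargeOrder m n = 2 * (n * n) ≤ 2 * m + 3 * (n ∸ 1)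

≤+⇒≤ : ∀ a c b → a + c ≡ b → a ≤ b
≤+⇒≤ a c b eq = subst (a ≤_) eq (m≤m+n a c)

2*≤2*+1⇒≤ : ∀ a b → 2 * a ≤ 2 * b + 1 → a ≤ b
2*≤2*+1⇒≤ a b le with a ≤? b
... | yes a≤b = a≤b
... | no a≰b = ⊥-elim (<⇒≱ (≤-trans (≤-reflexive (double-suc b)) (*-monoʳ-≤ 2 (≰⇒> a≰b))) le)
  where
  double-suc : ∀ b → suc (2 * b + 1) ≡ 2 * suc b
  double-suc = solve-∀

largeOrder⇒n+1≤m : ∀ m j → LargeOrder m (suc (suc j)) → suc j + 2 ≤ m
largeOrder⇒n+1≤m m j large = 2*≤2*+1⇒≤ (suc j + 2) m (+-cancelʳ-≤ (3 * suc j) _ _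
  (≤-trans (≤+⇒≤ _ (2 * j * j + 3 * j) _ (expand j)) (≤-trans (+-monoˡ-≤ 1 large) (≤-reflexive (swap m (3 * suc j))))))
  where
  expand : ∀ j → 2 * (suc j + 2) + 3 * suc j + (2 * j * j + 3 * j) ≡ 2 * (suc (suc j) * suc (suc j)) + 1
  expand = solve-∀
  swap : ∀ a b → 2 * a + b + 1 ≡ 2 * a + 1 + b
  swap = solve-∀

largeOrder⇒4k²+2k+4≤4m : ∀ m j → LargeOrder m (suc (suc j)) → 4 * suc j * suc j + 2 * suc j + 4 ≤ 4 * m
largeOrder⇒4k²+2k+4≤4m m j large =
  +-cancelʳ-≤ (6 * suc j) _ _ (subst₂ _≤_ (lhs j) (rhs m (suc j)) (*-monoʳ-≤ 2 large))
  where
  lhs : ∀ j → 2 * (2 * (suc (suc j) * suc (suc j))) ≡ (4 * suc j * suc j + 2 * suc j + 4) + 6 * suc j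
  lhs = solve-∀
  rhs : ∀ m k → 2 * (2 * m + 3 * k) ≡ 4 * m + 6 * k
  rhs = solve-∀

rowSum+e<columnSum : ∀ m j e → e ≤ 1 → suc j + 2 ≤ m →
  e + rowSum m (suc j) (2 * suc j + 1) < columnSum m (2 * suc j + 1)
rowSum+e<columnSum m j e e≤1 n<m =
  subst (λ m → e + rowSum m (suc j) (2 * suc j + 1) < columnSum m (2 * suc j + 1)) (m+[n∸m]≡n n<m)
    (≤-trans (s≤s (+-monoˡ-≤ (rowSum (suc j + 2 + x) (suc j) (2 * suc j + 1)) e≤1)) (≤+⇒≤ _ _ _ (identity j x)))
  where
  x : ℕ
  x = m ∸ (suc j + 2)
  identity : ∀ j x →
    suc (1 + (suc j * suc (2 * ((suc j + 2 + x) * (2 * suc j + 1))) + (suc j + 2 + x) * (2 * suc j + 1)))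
      + (3 * ((suc j + 2 + x) * (2 * suc j + 1)) + x * suc (2 * ((suc j + 2 + x) * (2 * suc j + 1))))
    ≡ (suc j + 2 + x) * suc (2 * ((suc j + 2 + x) * (2 * suc j + 1)))
  identity = solve-∀

-- Here D = 2m - 1 and τ = tri D, so that D + τ = tri (2m) bounds the number of edges of G.
core-identity : ∀ m0 k τ → 2 * τ + (2 * m0 + 1) ≡ (2 * m0 + 1) * (2 * m0 + 1) →
  columnSum (suc m0) (2 * k + 1) + τ + (4 * suc m0 * k * k + 2 * suc m0 * k + 3 * suc m0 + k)
  ≡ 2 * k * ((2 * m0 + 1) + τ) + rowSum (suc m0) k (2 * k + 1) + 1 + 4 * suc m0 * suc m0
core-identity m0 k τ τ-eq = *-cancelˡ-≡ _ _ 2 (+-cancelʳ-≡ (D + 2 * k * D) _ _ (begin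
    2 * (N + τ + Z) + (D + 2 * k * D)                   ≡⟨ lhs m0 k τ ⟩
    X + (2 * τ + D)                                     ≡⟨ cong (X +_) τ-eq ⟩
    X + D * D                                           ≡⟨ poly m0 k ⟩
    Y + 2 * k * (D * D)                                 ≡⟨ cong (λ z → Y + 2 * k * z) (sym τ-eq) ⟩
    Y + 2 * k * (2 * τ + D)                             ≡⟨ sym (rhs m0 k τ) ⟩
    2 * (2 * k * (D + τ) + S + 1 + 4 * m * m) + (D + 2 * k * D) ∎))
  where
  open ≡-Reasoning
  m : ℕ
  m = suc m0
  D : ℕ
  D = 2 * m0 + 1
  N : ℕ
  N = columnSum m (2 * k + 1)
  S : ℕ
  S = rowSum m k (2 * k + 1)
  Z : ℕ
  Z = 4 * m * k * k + 2 * m * k + 3 * m + k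
  X : ℕ
  X = 2 * m * suc (2 * (m * (2 * k + 1))) + 2 * Z + 2 * k * D
  Y : ℕ
  Y = 4 * k * D + 2 * S + 2 + 8 * m * m + D
  lhs : ∀ m0 k τ → 2 * (suc m0 * suc (2 * (suc m0 * (2 * k + 1))) + τ + (4 * suc m0 * k * k + 2 * suc m0 * k + 3 * suc m0 + k)) + ((2 * m0 + 1) + 2 * k * (2 * m0 + 1))
        ≡ (2 * suc m0 * suc (2 * (suc m0 * (2 * k + 1))) + 2 * (4 * suc m0 * k * k + 2 * suc m0 * k + 3 * suc m0 + k) + 2 * k * (2 * m0 + 1)) + (2 * τ + (2 * m0 + 1))
  lhs = solve-∀
  rhs : ∀ m0 k τ → 2 * (2 * k * ((2 * m0 + 1) + τ) + (k * suc (2 * (suc m0 * (2 * k + 1))) + suc m0 * (2 * k + 1)) + 1 + 4 * suc m0 * suc m0) + ((2 * m0 + 1) + 2 * k * (2 * m0 + 1))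
        ≡ (4 * k * (2 * m0 + 1) + 2 * (k * suc (2 * (suc m0 * (2 * k + 1))) + suc m0 * (2 * k + 1)) + 2 + 8 * suc m0 * suc m0 + (2 * m0 + 1)) + 2 * k * (2 * τ + (2 * m0 + 1))
  rhs = solve-∀
  poly : ∀ m0 k → (2 * suc m0 * suc (2 * (suc m0 * (2 * k + 1))) + 2 * (4 * suc m0 * k * k + 2 * suc m0 * k + 3 * suc m0 + k) + 2 * k * (2 * m0 + 1)) + (2 * m0 + 1) * (2 * m0 + 1)
        ≡ (4 * k * (2 * m0 + 1) + 2 * (k * suc (2 * (suc m0 * (2 * k + 1))) + suc m0 * (2 * k + 1)) + 2 + 8 * suc m0 * suc m0 + (2 * m0 + 1)) + 2 * k * ((2 * m0 + 1) * (2 * m0 + 1))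
  poly = solve-∀

core-inequality : ∀ m0 j → LargeOrder (suc m0) (suc (suc j)) →
  2 * suc j * ((2 * m0 + 1) + tri (2 * m0 + 1)) + rowSum (suc m0) (suc j) (2 * suc j + 1) + 1
  < columnSum (suc m0) (2 * suc j + 1) + tri (2 * m0 + 1)
core-inequality m0 j large = +-cancelʳ-< k _ _ (<-≤-trans (+-monoʳ-< L k<m) L+m≤R+k)
  where
  k : ℕ
  k = suc j
  m : ℕ
  m = suc m0
  L : ℕ
  L = 2 * k * ((2 * m0 + 1) + tri (2 * m0 + 1)) + rowSum m k (2 * k + 1) + 1
  R : ℕ
  R = columnSum m (2 * k + 1) + tri (2 * m0 + 1)
  Z : ℕ
  Z = 4 * m * k * k + 2 * m * k + 3 * m + k
  k<m : k < m
  k<m = ≤-trans (n≤1+n (suc k)) (≤-trans (≤-reflexive (+-comm 2 k)) (largeOrder⇒n+1≤m m j large))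
  L+Z+m≤R+Z+k : L + Z + m ≤ R + Z + k
  L+Z+m≤R+Z+k = begin
    L + Z + m                          ≡⟨ trans (+-assoc L Z m) (cong (L +_) (factor m k)) ⟩
    L + (m * (4 * k * k + 2 * k + 4) + k) ≤⟨ +-monoʳ-≤ L (+-monoˡ-≤ k (*-monoʳ-≤ m (largeOrder⇒4k²+2k+4≤4m m j large))) ⟩
    L + (m * (4 * m) + k)              ≡⟨ cong (λ z → L + (z + k)) (*-comm m (4 * m)) ⟩
    L + (4 * m * m + k)                ≡⟨ sym (+-assoc L _ k) ⟩
    L + 4 * m * m + k                  ≡⟨ cong (_+ k) (sym (core-identity m0 k (tri (2 * m0 + 1)) (2*tri+n≡n*n (2 * m0 + 1)))) ⟩
    R + Z + k                          ∎
    where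
    open ≤-Reasoning
    factor : ∀ m k → 4 * m * k * k + 2 * m * k + 3 * m + k + m ≡ m * (4 * k * k + 2 * k + 4) + k
    factor = solve-∀
  L+m≤R+k : L + m ≤ R + k
  L+m≤R+k = +-cancelʳ-≤ Z _ _ (subst₂ _≤_ (swap L Z m) (swap R Z k) L+Z+m≤R+Z+k)
    where
    swap : ∀ a b c → a + b + c ≡ a + c + b
    swap = solve-∀

outerColour<innerColour : ∀ m j q F e → 1 ≤ m → 2 * m < 2 * suc j + 1 →
  2 * m * q + columnSum m (2 * suc j + 1) < F + ((2 * suc j + 1) * q + (e + rowSum m (suc j) (2 * suc j + 1)))
outerColour<innerColour m j q F e 1≤m 2m<K =
  ≤-trans (+-mono-≤-< (*-monoˡ-≤ q (≤-trans (n≤1+n _) 2m<K)) N<S)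
          (≤-trans (+-monoʳ-≤ (K * q) (m≤n+m S e)) (m≤n+m _ F))
  where
  K : ℕ
  K = 2 * suc j + 1
  N : ℕ
  N = suc (2 * (m * K))
  S : ℕ
  S = rowSum m (suc j) K
  m≤k : m ≤ suc j
  m≤k = *-cancelˡ-≤ 2 (≤-pred (subst (suc (2 * m) ≤_) (+-comm (2 * suc j) 1) 2m<K))
  N<S : m * N < S
  N<S = <-≤-trans (subst (_< m * N + m * K) (+-identityʳ (m * N)) (+-monoʳ-< (m * N) (≤-trans 1≤m (m≤m*n m K))))
                  (+-monoˡ-≤ (m * K) (*-monoˡ-≤ N m≤k))

innerColour<outerColour-sparse : ∀ m D c d k q ES N → c + d ≡ D → 2 * m ≡ suc D → 2 * k ≤ d → ES < N →
  c * q + ((2 * k + 1) * q + ES) < 2 * m * q + N + tri c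
innerColour<outerColour-sparse m D c d k q ES N c+d≡D 2m≡ 2k≤d ES<N = begin-strict
  c * q + ((2 * k + 1) * q + ES)  ≡⟨ sym (distrib c (2 * k + 1) q ES) ⟩
  (c + (2 * k + 1)) * q + ES      ≤⟨ +-monoˡ-≤ ES (*-monoˡ-≤ q c+K≤2m) ⟩
  2 * m * q + ES                  <⟨ +-monoʳ-< (2 * m * q) ES<N ⟩
  2 * m * q + N                   ≤⟨ m≤m+n _ (tri c) ⟩
  2 * m * q + N + tri c           ∎
  where
  open ≤-Reasoning
  distrib : ∀ c K q E → (c + K) * q + E ≡ c * q + (K * q + E)
  distrib = solve-∀
  c+K≤2m : c + (2 * k + 1) ≤ 2 * m
  c+K≤2m = begin
    c + (2 * k + 1)  ≤⟨ +-monoʳ-≤ c (+-monoˡ-≤ 1 2k≤d) ⟩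
    c + (d + 1)      ≡⟨ sym (+-assoc c d 1) ⟩
    c + d + 1        ≡⟨ cong (_+ 1) c+d≡D ⟩
    D + 1            ≡⟨ +-comm D 1 ⟩
    suc D            ≡⟨ sym 2m≡ ⟩
    2 * m            ∎

innerColour<outerColour-dense : ∀ m D c d x k q N S e → c + d ≡ D → d + x ≡ 2 * k → 2 * m ≡ suc D →
  q ≤ D + tri D → e ≤ 1 → 2 * k * (D + tri D) + S + 1 < N + tri D →
  c * q + ((2 * k + 1) * q + (e + S)) < 2 * m * q + N + tri c
innerColour<outerColour-dense m D c d x k q N S e c+d≡D d+x≡2k 2m≡ q≤Q e≤1 core = begin-strict
  c * q + ((2 * k + 1) * q + (e + S))  ≡⟨ cong (λ z → c * q + ((z + 1) * q + (e + S))) (sym d+x≡2k) ⟩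
  c * q + ((d + x + 1) * q + (e + S))  ≡⟨ expand c d x q (e + S) ⟩
  suc (c + d) * q + x * q + (e + S)    ≡⟨ cong (λ z → z * q + x * q + (e + S)) (trans (cong suc c+d≡D) (sym 2m≡)) ⟩
  2 * m * q + x * q + (e + S)          ≡⟨ +-assoc (2 * m * q) (x * q) (e + S) ⟩
  2 * m * q + (x * q + (e + S))        <⟨ +-monoʳ-< (2 * m * q) excess< ⟩
  2 * m * q + (N + tri c)              ≡⟨ sym (+-assoc (2 * m * q) N (tri c)) ⟩
  2 * m * q + N + tri c                ∎
  where
  open ≤-Reasoning
  Q : ℕ
  Q = D + tri D
  expand : ∀ c d x q E → c * q + ((d + x + 1) * q + E) ≡ suc (c + d) * q + x * q + E
  expand = solve-∀
  regroup : ∀ x E d Q → x * Q + E + d * Q ≡ (d + x) * Q + E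
  regroup = solve-∀
  shift : ∀ a S → a + (1 + S) ≡ a + S + 1
  shift = solve-∀
  triD≤ : tri D ≤ tri c + d * Q
  triD≤ = begin
    tri D                     ≡⟨ cong tri (sym c+d≡D) ⟩
    tri (c + d)               ≡⟨ tri-+ c d ⟩
    tri c + (d * c + tri d)   ≤⟨ +-monoʳ-≤ (tri c) (+-monoʳ-≤ (d * c) (tri≤n*n d)) ⟩
    tri c + (d * c + d * d)   ≡⟨ cong (tri c +_) (sym (*-distribˡ-+ d c d)) ⟩
    tri c + d * (c + d)       ≤⟨ +-monoʳ-≤ (tri c) (*-monoʳ-≤ d (≤-trans (≤-reflexive c+d≡D) (m≤m+n D (tri D)))) ⟩
    tri c + d * Q             ∎
  excess< : x * q + (e + S) < N + tri c
  excess< = ≤-<-trans (+-monoˡ-≤ (e + S) (*-monoʳ-≤ x q≤Q)) (+-cancelʳ-< (d * Q) _ _ (begin-strict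
    x * Q + (e + S) + d * Q  ≡⟨ regroup x (e + S) d Q ⟩
    (d + x) * Q + (e + S)    ≡⟨ cong (λ z → z * Q + (e + S)) d+x≡2k ⟩
    2 * k * Q + (e + S)      ≤⟨ +-monoʳ-≤ (2 * k * Q) (+-monoˡ-≤ S e≤1) ⟩
    2 * k * Q + (1 + S)      ≡⟨ shift (2 * k * Q) S ⟩
    2 * k * Q + S + 1        <⟨ core ⟩
    N + tri D                ≤⟨ +-monoʳ-≤ N triD≤ ⟩
    N + (tri c + d * Q)      ≡⟨ sym (+-assoc N (tri c) (d * Q)) ⟩
    N + tri c + d * Q        ∎))

-- Comparing c + K with 2m = D + 1: if c + K ≤ 2m
-- the row sum alone stays below the column sum; otherwise the surplus (c + K - 2m) q is paid for by
-- q ≤ tri (2m) and tri D ≤ tri c + (D - c) tri (2m), and the core inequality absorbs it.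
innerColour<outerColour : ∀ m j q c F e → e ≤ 1 → F + tri c ≤ c * q → suc c ≤ 2 * m → q ≤ tri (2 * m) →
  LargeOrder m (suc (suc j)) →
  F + ((2 * suc j + 1) * q + (e + rowSum m (suc j) (2 * suc j + 1))) < 2 * m * q + columnSum m (2 * suc j + 1)
innerColour<outerColour zero j q c F e e≤1 F-bound () q≤ large
innerColour<outerColour (suc m0) j q c F e e≤1 F-bound c<2m q≤ large =
  +-cancelʳ-< (tri c) _ _ (≤-<-trans (subst (_≤ c * q + (K * q + (e + S))) (swap F (K * q + (e + S)) (tri c))
                                               (+-monoˡ-≤ (K * q + (e + S)) F-bound))
                                     inner<outer)
  where
  m : ℕ
  m = suc m0
  k : ℕ
  k = suc j
  K : ℕ
  K = 2 * k + 1
  S : ℕ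
  S = rowSum m k K
  D : ℕ
  D = 2 * m0 + 1
  swap : ∀ a b c → a + c + b ≡ a + b + c
  swap = solve-∀
  2m≡D+1 : 2 * m ≡ suc D
  2m≡D+1 = double-suc m0
    where
    double-suc : ∀ m0 → 2 * suc m0 ≡ suc (2 * m0 + 1)
    double-suc = solve-∀
  d : ℕ
  d = D ∸ c
  c+d≡D : c + d ≡ D
  c+d≡D = m+[n∸m]≡n (≤-pred (subst (suc c ≤_) 2m≡D+1 c<2m))
  inner<outer : c * q + (K * q + (e + S)) < 2 * m * q + columnSum m K + tri c
  inner<outer with 2 * k ≤? d
  ... | yes 2k≤d = innerColour<outerColour-sparse m D c d k q (e + S) (columnSum m K) c+d≡D 2m≡D+1 2k≤d
                     (rowSum+e<columnSum m j e e≤1 (largeOrder⇒n+1≤m m j large))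
  ... | no 2k≰d = innerColour<outerColour-dense m D c d (2 * k ∸ d) k q (columnSum m K) S e c+d≡D
                    (m+[n∸m]≡n (≤-pred (≤-trans (≰⇒> 2k≰d) (n≤1+n _))))
                    2m≡D+1 (subst (q ≤_) (trans (cong tri 2m≡D+1) (tri-suc D)) q≤) e≤1 (core-inequality m0 j large)

-- Rows are indexed by a side s and a rank r < m of a vertex within its side; entry s r c, raised by the
-- number q of edges of G, labels the edge from that vertex to the c-th vertex of O_W.
record BalancedArray (m k W : ℕ) : Set where
  field
    entry            : Bool → ℕ → ℕ → ℕ
    entry-bounds     : ∀ s r c → r < m → c < W → 1 ≤ entry s r c × entry s r c ≤ 2 * (m * W)
    entry-injective  : ∀ s r c s′ r′ c′ → r < m → c < W → r′ < m → c′ < W →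
                       entry s r c ≡ entry s′ r′ c′ → (s , r , c) ≡ (s′ , r′ , c′)
    entry-surjective : ∀ v → 1 ≤ v → v ≤ 2 * (m * W) →
                       ∃[ s ] ∃[ r ] ∃[ c ] (r < m × c < W × entry s r c ≡ v)
    row-sum          : ∀ s r → r < m → sumBelow W (entry s r) ≡ 𝟙 (not s) + rowSum m k W
    column-sum       : ∀ c → c < W → sumBelow m (λ r → entry true r c + entry false r c) ≡ columnSum m W

≤⇒≤ᵇ≡true : ∀ {a b} → a ≤ b → (a ≤ᵇ b) ≡ true
≤⇒≤ᵇ≡true a≤b = Equivalence.to T-≡ (≤⇒≤ᵇ a≤b)

>⇒≤ᵇ≡false : ∀ {a b} → b < a → (a ≤ᵇ b) ≡ false
>⇒≤ᵇ≡false {a} {b} b<a with a ≤ᵇ b in eq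
... | false = refl
... | true = ⊥-elim (<⇒≱ b<a (≤ᵇ⇒≤ a b (Equivalence.from T-≡ eq)))

≤ᵇ≡true⇒≤ : ∀ {a b} → (a ≤ᵇ b) ≡ true → a ≤ b
≤ᵇ≡true⇒≤ {a} {b} eq = ≤ᵇ⇒≤ a b (Equivalence.from T-≡ eq)

≤ᵇ≡false⇒> : ∀ {a b} → (a ≤ᵇ b) ≡ false → b < a
≤ᵇ≡false⇒> eq = ≰⇒> (λ a≤b → subst T eq (≤⇒≤ᵇ a≤b))

<⇒<ᵇ≡true : ∀ {a b} → a < b → (a <ᵇ b) ≡ true
<⇒<ᵇ≡true a<b = Equivalence.to T-≡ (<⇒<ᵇ a<b)

≥⇒<ᵇ≡false : ∀ {a b} → b ≤ a → (a <ᵇ b) ≡ false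
≥⇒<ᵇ≡false {a} {b} b≤a with a <ᵇ b in eq
... | false = refl
... | true = ⊥-elim (<⇒≱ (<ᵇ⇒< a b (Equivalence.from T-≡ eq)) b≤a)

<ᵇ≡true⇒< : ∀ {a b} → (a <ᵇ b) ≡ true → a < b
<ᵇ≡true⇒< {a} {b} eq = <ᵇ⇒< a b (Equivalence.from T-≡ eq)

<ᵇ≡false⇒≥ : ∀ {a b} → (a <ᵇ b) ≡ false → b ≤ a
<ᵇ≡false⇒≥ eq = ≮⇒≥ (λ a<b → subst T eq (<⇒<ᵇ a<b))

isAbove : ℕ → ℕ → ℕ
isAbove M x = 𝟙 (M <ᵇ x)

>⇒isAbove≡1 : ∀ {M x} → M < x → isAbove M x ≡ 1
>⇒isAbove≡1 M<x rewrite <⇒<ᵇ≡true M<x = refl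

≤⇒isAbove≡0 : ∀ {M x} → x ≤ M → isAbove M x ≡ 0
≤⇒isAbove≡0 x≤M rewrite ≥⇒<ᵇ≡false x≤M = refl

data Slot : Set where
  low middle high : Slot

every-slot : {P : Slot → Set} → P low → P middle → P high → ∀ σ → P σ
every-slot l m h low = l
every-slot l m h middle = m
every-slot l m h high = h

-- For a literal c the hidden argument has type ⊤ and is filled in by eta.
<3 : ∀ {c} {c<3 : T (c <ᵇ 3)} → c < 3
<3 {c} {c<3} = <ᵇ⇒< c 3 c<3

every-column : {P : ℕ → Set} → P 0 → P 1 → P 2 → ∀ c → c < 3 → P c
every-column p₀ p₁ p₂ 0 _ = p₀
every-column p₀ p₁ p₂ 1 _ = p₁
every-column p₀ p₁ p₂ 2 _ = p₂
every-column p₀ p₁ p₂ (suc (suc (suc c))) (s≤s (s≤s (s≤s ())))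

-- An arrangement is named by the order of the slots in the row of side true.
data Arrangement : Set where
  LHM HLM MHL LMH : Arrangement

slotOrder : Bool → Arrangement → Slot × Slot × Slot
slotOrder true LHM = low , high , middle
slotOrder true HLM = high , low , middle
slotOrder true MHL = middle , high , low
slotOrder true LMH = low , middle , high
slotOrder false LHM = high , low , middle
slotOrder false HLM = low , high , middle
slotOrder false MHL = high , middle , low
slotOrder false LMH = middle , low , high

slotAt : Bool → Arrangement → ℕ → Slot
slotAt s a zero = proj₁ (slotOrder s a)
slotAt s a (suc zero) = proj₁ (proj₂ (slotOrder s a))
slotAt s a (suc (suc _)) = proj₂ (proj₂ (slotOrder s a))

columnOf : Bool → Arrangement → Slot → ℕ
columnOf true LHM = every-slot 0 2 1
columnOf true HLM = every-slot 1 2 0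
columnOf true MHL = every-slot 2 0 1
columnOf true LMH = every-slot 0 1 2
columnOf false LHM = every-slot 1 2 0
columnOf false HLM = every-slot 0 2 1
columnOf false MHL = every-slot 2 1 0
columnOf false LMH = every-slot 1 0 2

slotAt-columnOf : ∀ s a σ → slotAt s a (columnOf s a σ) ≡ σ
slotAt-columnOf true LHM = every-slot refl refl refl
slotAt-columnOf true HLM = every-slot refl refl refl
slotAt-columnOf true MHL = every-slot refl refl refl
slotAt-columnOf true LMH = every-slot refl refl refl
slotAt-columnOf false LHM = every-slot refl refl refl
slotAt-columnOf false HLM = every-slot refl refl refl
slotAt-columnOf false MHL = every-slot refl refl refl
slotAt-columnOf false LMH = every-slot refl refl refl

columnOf-slotAt : ∀ s a c → c < 3 → columnOf s a (slotAt s a c) ≡ c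
columnOf-slotAt true LHM = every-column refl refl refl
columnOf-slotAt true HLM = every-column refl refl refl
columnOf-slotAt true MHL = every-column refl refl refl
columnOf-slotAt true LMH = every-column refl refl refl
columnOf-slotAt false LHM = every-column refl refl refl
columnOf-slotAt false HLM = every-column refl refl refl
columnOf-slotAt false MHL = every-column refl refl refl
columnOf-slotAt false LMH = every-column refl refl refl

columnOf<3 : ∀ s a σ → columnOf s a σ < 3
columnOf<3 true LHM = every-slot <3 <3 <3
columnOf<3 true HLM = every-slot <3 <3 <3
columnOf<3 true MHL = every-slot <3 <3 <3
columnOf<3 true LMH = every-slot <3 <3 <3
columnOf<3 false LHM = every-slot <3 <3 <3
columnOf<3 false HLM = every-slot <3 <3 <3
columnOf<3 false MHL = every-slot <3 <3 <3
columnOf<3 false LMH = every-slot <3 <3 <3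

private
  +-perm-xyz : ∀ x y z → x + (y + (z + 0)) ≡ x + y + z
  +-perm-xyz = solve-∀
  +-perm-xzy : ∀ x y z → x + (z + (y + 0)) ≡ x + y + z
  +-perm-xzy = solve-∀
  +-perm-yxz : ∀ x y z → y + (x + (z + 0)) ≡ x + y + z
  +-perm-yxz = solve-∀
  +-perm-yzx : ∀ x y z → y + (z + (x + 0)) ≡ x + y + z
  +-perm-yzx = solve-∀
  +-perm-zxy : ∀ x y z → z + (x + (y + 0)) ≡ x + y + z
  +-perm-zxy = solve-∀
  +-perm-zyx : ∀ x y z → z + (y + (x + 0)) ≡ x + y + z
  +-perm-zyx = solve-∀

sum-slots : ∀ s a (F : Slot → ℕ) → sumBelow 3 (F ∘ slotAt s a) ≡ F low + F middle + F high
sum-slots true LHM F = +-perm-xzy (F low) (F middle) (F high)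
sum-slots true HLM F = +-perm-zxy (F low) (F middle) (F high)
sum-slots true MHL F = +-perm-yzx (F low) (F middle) (F high)
sum-slots true LMH F = +-perm-xyz (F low) (F middle) (F high)
sum-slots false LHM F = +-perm-zxy (F low) (F middle) (F high)
sum-slots false HLM F = +-perm-xzy (F low) (F middle) (F high)
sum-slots false MHL F = +-perm-zyx (F low) (F middle) (F high)
sum-slots false LMH F = +-perm-yxz (F low) (F middle) (F high)

close-with-tri : ∀ P N t n → P + n * n ≡ N + n → 2 * t + n ≡ n * n → P + 2 * t ≡ N
close-with-tri P N t n eq tri-eq = +-cancelʳ-≡ n _ _ (trans (+-assoc P (2 * t) n) (trans (cong (P +_) tri-eq) eq))

∸-suc-+ : ∀ {r m} → r < m → suc (r + (m ∸ suc r)) ≡ m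
∸-suc-+ {r} {m} r<m = trans (cong suc (+-comm r (m ∸ suc r))) (trans (sym (+-suc (m ∸ suc r) r)) (m∸n+n≡m r<m))

-- Row (true, r) holds 2r+1, 3m-r, 6m-r and row (false, r) holds 2r+2, 4m-r, 5m-r, which together
-- enumerate [1, 6m]; the arrangement of row r decides in which column each slot goes.
module BaseArray (m : ℕ) (arrangement : ℕ → Arrangement) where

  mirror : ℕ → ℕ
  mirror r = m ∸ suc r

  -- Facts about mirror r are proved by generalising m to suc (r + x), where they become ring identities.
  mirror-sum : ∀ {r} → r < m → suc (r + mirror r) ≡ m
  mirror-sum = ∸-suc-+

  mirror<m : ∀ {r} → r < m → mirror r < m
  mirror<m {r} r<m = subst (mirror r <_) (trans (cong suc (+-comm (mirror r) r)) (mirror-sum r<m)) (m≤m+n (suc (mirror r)) r)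

  mirror-involutive : ∀ {r} → r < m → mirror (mirror r) ≡ r
  mirror-involutive {r} r<m = go r (mirror r) m (mirror-sum r<m)
    where
    go : ∀ r x m → suc (r + x) ≡ m → m ∸ suc x ≡ r
    go r x .(suc (r + x)) refl = m+n∸n≡m r x

  baseValue : Bool → ℕ → Slot → ℕ
  baseValue true r low = suc (r + r)
  baseValue true r middle = suc (2 * m + mirror r)
  baseValue true r high = suc (5 * m + mirror r)
  baseValue false r low = suc (suc (r + r))
  baseValue false r middle = suc (3 * m + mirror r)
  baseValue false r high = suc (4 * m + mirror r)

  baseEntry : Bool → ℕ → ℕ → ℕ
  baseEntry s r c = baseValue s r (slotAt s (arrangement r) c)

  base-row-sum : ∀ s r → r < m → sumBelow 3 (baseEntry s r) ≡ 𝟙 (not s) + rowSum m 1 3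
  base-row-sum true r r<m = trans (sum-slots true (arrangement r) (baseValue true r)) (slots r (mirror r) m (mirror-sum r<m))
    where
    slots : ∀ r x m → suc (r + x) ≡ m → suc (r + r) + suc (2 * m + x) + suc (5 * m + x) ≡ 0 + (1 * suc (2 * (m * 3)) + m * 3)
    slots r x .(suc (r + x)) refl = solve (r ∷ x ∷ [])
  base-row-sum false r r<m = trans (sum-slots false (arrangement r) (baseValue false r)) (slots r (mirror r) m (mirror-sum r<m))
    where
    slots : ∀ r x m → suc (r + x) ≡ m → suc (suc (r + r)) + suc (3 * m + x) + suc (4 * m + x) ≡ 1 + (1 * suc (2 * (m * 3)) + m * 3)
    slots r x .(suc (r + x)) refl = solve (r ∷ x ∷ [])

  aboveSlot : Bool → Slot → ℕ
  aboveSlot s low = 0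
  aboveSlot s middle = 𝟙 (not s)
  aboveSlot s high = 1

  isAbove-baseValue : ∀ s r σ → r < m → isAbove (m * 3) (baseValue s r σ) ≡ aboveSlot s σ
  isAbove-baseValue true r low r<m = ≤⇒isAbove≡0 (bound r (mirror r) m (mirror-sum r<m))
    where
    bound : ∀ r x m → suc (r + x) ≡ m → suc (r + r) ≤ m * 3
    bound r x .(suc (r + x)) refl = ≤+⇒≤ _ (r + 3 * x + 2) _ (solve (r ∷ x ∷ []))
  isAbove-baseValue false r low r<m = ≤⇒isAbove≡0 (bound r (mirror r) m (mirror-sum r<m))
    where
    bound : ∀ r x m → suc (r + x) ≡ m → suc (suc (r + r)) ≤ m * 3
    bound r x .(suc (r + x)) refl = ≤+⇒≤ _ (r + 3 * x + 1) _ (solve (r ∷ x ∷ []))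
  isAbove-baseValue true r middle r<m = ≤⇒isAbove≡0 (bound r (mirror r) m (mirror-sum r<m))
    where
    bound : ∀ r x m → suc (r + x) ≡ m → suc (2 * m + x) ≤ m * 3
    bound r x .(suc (r + x)) refl = ≤+⇒≤ _ r _ (solve (r ∷ x ∷ []))
  isAbove-baseValue false r middle _ = >⇒isAbove≡1 (s≤s (≤+⇒≤ (m * 3) (mirror r) _ (expand m (mirror r))))
    where
    expand : ∀ m x → m * 3 + x ≡ 3 * m + x
    expand = solve-∀
  isAbove-baseValue true r high _ = >⇒isAbove≡1 (s≤s (≤+⇒≤ (m * 3) (2 * m + mirror r) _ (expand m (mirror r))))
    where
    expand : ∀ m x → m * 3 + (2 * m + x) ≡ 5 * m + x
    expand = solve-∀
  isAbove-baseValue false r high _ = >⇒isAbove≡1 (s≤s (≤+⇒≤ (m * 3) (m + mirror r) _ (expand m (mirror r))))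
    where
    expand : ∀ m x → m * 3 + (m + x) ≡ 4 * m + x
    expand = solve-∀

  base-row-above : ∀ s r → r < m → sumBelow 3 (λ c → isAbove (m * 3) (baseEntry s r c)) ≡ suc (𝟙 (not s))
  base-row-above s r r<m = trans (sum-slots s (arrangement r) (λ σ → isAbove (m * 3) (baseValue s r σ)))
    (trans (cong₂ _+_ (cong₂ _+_ (isAbove-baseValue s r low r<m) (isAbove-baseValue s r middle r<m)) (isAbove-baseValue s r high r<m))
           (+-comm (𝟙 (not s)) 1))

  halve : ℕ → ℕ × Bool
  halve zero = 0 , true
  halve (suc zero) = 0 , false
  halve (suc (suc n)) = suc (proj₁ (halve n)) , proj₂ (halve n)

  halve-even : ∀ r → halve (r + r) ≡ (r , true)
  halve-even zero = refl
  halve-even (suc r) rewrite +-suc r r | halve-even r = refl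

  halve-odd : ∀ r → halve (suc (r + r)) ≡ (r , false)
  halve-odd zero = refl
  halve-odd (suc r) rewrite +-suc r r | halve-odd r = refl

  halve-correct : ∀ x → let (h , even) = halve x in
    (even ≡ true × h + h ≡ x) ⊎ (even ≡ false × suc (h + h) ≡ x)
  halve-correct zero = inj₁ (refl , refl)
  halve-correct (suc zero) = inj₂ (refl , refl)
  halve-correct (suc (suc n)) with halve-correct n
  ... | inj₁ (even , eq) = inj₁ (even , trans (cong suc (+-suc (proj₁ (halve n)) _)) (cong (2 +_) eq))
  ... | inj₂ (odd , eq) = inj₂ (odd , trans (cong (2 +_) (+-suc (proj₁ (halve n)) _)) (cong (2 +_) eq))

  baseDecode : ℕ → Bool × ℕ × Slot
  baseDecode zero = true , 0 , low
  baseDecode (suc x) =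
    if suc x ≤ᵇ 2 * m then (proj₂ (halve x) , proj₁ (halve x) , low)
    else if suc x ≤ᵇ 3 * m then (true , mirror (x ∸ 2 * m) , middle)
    else if suc x ≤ᵇ 4 * m then (false , mirror (x ∸ 3 * m) , middle)
    else if suc x ≤ᵇ 5 * m then (false , mirror (x ∸ 4 * m) , high)
    else (true , mirror (x ∸ 5 * m) , high)

  block-top : ∀ a x → x < m → suc (a * m + x) ≤ suc a * m
  block-top a x x<m = go a x (m ∸ suc x) m (∸-suc-+ x<m)
    where
    go : ∀ a x y m → suc (x + y) ≡ m → suc (a * m + x) ≤ suc a * m
    go a x y .(suc (x + y)) refl = ≤+⇒≤ _ y _ (solve (a ∷ x ∷ y ∷ []))

  private
    block-bottom : ∀ a b x → a ≤ b → a * m < suc (b * m + x)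
    block-bottom a b x a≤b = s≤s (≤-trans (*-monoˡ-≤ m a≤b) (m≤m+n _ _))

    odd≤2m : ∀ r x m → suc (r + x) ≡ m → suc (r + r) ≤ 2 * m
    odd≤2m r x .(suc (r + x)) refl = ≤+⇒≤ _ (1 + 2 * x) _ (solve (r ∷ x ∷ []))

    even≤2m : ∀ r x m → suc (r + x) ≡ m → suc (suc (r + r)) ≤ 2 * m
    even≤2m r x .(suc (r + x)) refl = ≤+⇒≤ _ (2 * x) _ (solve (r ∷ x ∷ []))

  baseDecode-baseValue : ∀ s r σ → r < m → baseDecode (baseValue s r σ) ≡ (s , r , σ)
  baseDecode-baseValue true r low r<m rewrite ≤⇒≤ᵇ≡true (odd≤2m r (mirror r) m (mirror-sum r<m)) | halve-even r = refl
  baseDecode-baseValue false r low r<m rewrite ≤⇒≤ᵇ≡true (even≤2m r (mirror r) m (mirror-sum r<m)) | halve-odd r = refl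
  baseDecode-baseValue true r middle r<m
    rewrite >⇒≤ᵇ≡false (block-bottom 2 2 (mirror r) ≤-refl)
          | ≤⇒≤ᵇ≡true (block-top 2 (mirror r) (mirror<m r<m))
          | m+n∸m≡n (2 * m) (mirror r) | mirror-involutive r<m = refl
  baseDecode-baseValue false r middle r<m
    rewrite >⇒≤ᵇ≡false (block-bottom 2 3 (mirror r) (s≤s (s≤s z≤n)))
          | >⇒≤ᵇ≡false (block-bottom 3 3 (mirror r) ≤-refl)
          | ≤⇒≤ᵇ≡true (block-top 3 (mirror r) (mirror<m r<m))
          | m+n∸m≡n (3 * m) (mirror r) | mirror-involutive r<m = refl
  baseDecode-baseValue false r high r<m
    rewrite >⇒≤ᵇ≡false (block-bottom 2 4 (mirror r) (s≤s (s≤s z≤n)))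
          | >⇒≤ᵇ≡false (block-bottom 3 4 (mirror r) (s≤s (s≤s (s≤s z≤n))))
          | >⇒≤ᵇ≡false (block-bottom 4 4 (mirror r) ≤-refl)
          | ≤⇒≤ᵇ≡true (block-top 4 (mirror r) (mirror<m r<m))
          | m+n∸m≡n (4 * m) (mirror r) | mirror-involutive r<m = refl
  baseDecode-baseValue true r high r<m
    rewrite >⇒≤ᵇ≡false (block-bottom 2 5 (mirror r) (s≤s (s≤s z≤n)))
          | >⇒≤ᵇ≡false (block-bottom 3 5 (mirror r) (s≤s (s≤s (s≤s z≤n))))
          | >⇒≤ᵇ≡false (block-bottom 4 5 (mirror r) (s≤s (s≤s (s≤s (s≤s z≤n)))))
          | >⇒≤ᵇ≡false (block-bottom 5 5 (mirror r) ≤-refl)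
          | m+n∸m≡n (5 * m) (mirror r) | mirror-involutive r<m = refl

  BaseDecodes : Bool × ℕ × Slot → ℕ → Set
  BaseDecodes (s , r , σ) v = r < m × baseValue s r σ ≡ v

  private
    half<m : ∀ {r} → suc (r + r) ≤ 2 * m → r < m
    half<m {r} le = ≰⇒> (λ m≤r → n≮n (r + r) (≤-trans le (subst (2 * m ≤_) (cong (r +_) (+-identityʳ r)) (*-monoʳ-≤ 2 m≤r))))

    in-block : ∀ a x s σ → a * m ≤ x → x < suc a * m → (∀ r → baseValue s r σ ≡ suc (a * m + mirror r)) →
               BaseDecodes (s , mirror (x ∸ a * m) , σ) (suc x)
    in-block a x s σ lo hi value = mirror<m y<m ,
        trans (value _) (cong suc (trans (cong (a * m +_) (mirror-involutive y<m)) (m+[n∸m]≡n lo)))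
      where
      y<m : x ∸ a * m < m
      y<m = +-cancelˡ-< (a * m) _ _ (subst (_< a * m + m) (sym (m+[n∸m]≡n lo)) (subst (x <_) (+-comm m (a * m)) hi))

  baseValue-baseDecode : ∀ x → x < 6 * m → BaseDecodes (baseDecode (suc x)) (suc x)
  baseValue-baseDecode x x<6m with suc x ≤ᵇ 2 * m in le₂
  ... | true with halve-correct x
  ...   | inj₁ (even , eq) rewrite even = half<m (subst (_≤ 2 * m) (cong suc (sym eq)) (≤ᵇ≡true⇒≤ le₂)) , cong suc eq
  ...   | inj₂ (odd , eq) rewrite odd = half<m (≤-trans (n≤1+n _) (subst (_≤ 2 * m) (cong suc (sym eq)) (≤ᵇ≡true⇒≤ le₂))) , cong suc eq
  baseValue-baseDecode x x<6m | false with suc x ≤ᵇ 3 * m in le₃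
  ... | true = in-block 2 x true middle (≤-pred (≤ᵇ≡false⇒> le₂)) (≤ᵇ≡true⇒≤ le₃) (λ _ → refl)
  ... | false with suc x ≤ᵇ 4 * m in le₄
  ... | true = in-block 3 x false middle (≤-pred (≤ᵇ≡false⇒> le₃)) (≤ᵇ≡true⇒≤ le₄) (λ _ → refl)
  ... | false with suc x ≤ᵇ 5 * m in le₅
  ... | true = in-block 4 x false high (≤-pred (≤ᵇ≡false⇒> le₄)) (≤ᵇ≡true⇒≤ le₅) (λ _ → refl)
  ... | false = in-block 5 x true high (≤-pred (≤ᵇ≡false⇒> le₅)) x<6m (λ _ → refl)

  low+high≡ : ∀ r → r < m → baseValue true r low + baseValue false r high ≡ (5 * m + 1) + r
  low+high≡ r r<m = go r (mirror r) m (mirror-sum r<m)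
    where
    go : ∀ r x m → suc (r + x) ≡ m → suc (r + r) + suc (4 * m + x) ≡ (5 * m + 1) + r
    go r x .(suc (r + x)) refl = solve (r ∷ x ∷ [])

  high+low≡ : ∀ r → r < m → baseValue true r high + baseValue false r low ≡ (6 * m + 2) + r
  high+low≡ r r<m = go r (mirror r) m (mirror-sum r<m)
    where
    go : ∀ r x m → suc (r + x) ≡ m → suc (5 * m + x) + suc (suc (r + r)) ≡ (6 * m + 2) + r
    go r x .(suc (r + x)) refl = solve (r ∷ x ∷ [])

  middlePair : ℕ → ℕ
  middlePair r = baseValue true r middle + baseValue false r middle

  sum-middlePair : sumBelow m middlePair ≡ columnSum m 3
  sum-middlePair = begin
    sumBelow m middlePair                                          ≡⟨ sumBelow-cong m (λ r _ → expand m (mirror r)) ⟩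
    sumBelow m (λ r → (5 * m + 2) + 2 * mirror r)                  ≡⟨ sumBelow-+ m (λ _ → 5 * m + 2) (λ r → 2 * mirror r) ⟩
    sumBelow m (λ _ → 5 * m + 2) + sumBelow m (λ r → 2 * mirror r) ≡⟨ cong₂ _+_ (sumBelow-const m _)
                                                                        (trans (sumBelow-* m 2 mirror) (cong (2 *_) (sumBelow-reverse m))) ⟩
    m * (5 * m + 2) + 2 * tri m                                    ≡⟨ close-with-tri (m * (5 * m + 2)) (m * suc (2 * (m * 3))) (tri m) m (solve (m ∷ [])) (2*tri+n≡n*n m) ⟩
    columnSum m 3                                                  ∎
    where
    open ≡-Reasoning
    expand : ∀ m x → suc (2 * m + x) + suc (3 * m + x) ≡ (5 * m + 2) + 2 * x
    expand = solve-∀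

  pairInColumn : ℕ → Arrangement → ℕ → ℕ
  pairInColumn c a r = baseValue true r (slotAt true a c) + baseValue false r (slotAt false a c)

  ColumnsBalanced : Set
  ColumnsBalanced = ∀ c → c < 3 → sumBelow m (λ r → baseEntry true r c + baseEntry false r c) ≡ columnSum m 3

  ColumnsHalfAbove : Set
  ColumnsHalfAbove = ∀ c → c < 3 →
    sumBelow m (λ r → isAbove (m * 3) (baseEntry true r c) + isAbove (m * 3) (baseEntry false r c)) ≡ m

  baseValue-bounds : ∀ s r σ → r < m → 1 ≤ baseValue s r σ × baseValue s r σ ≤ 2 * (m * 3)
  baseValue-bounds s r σ r<m = positive s σ , ≤-trans (bounded s σ) (≤-reflexive (six m))
    where
    six : ∀ m → 6 * m ≡ 2 * (m * 3)
    six = solve-∀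
    positive : ∀ s σ → 1 ≤ baseValue s r σ
    positive true low = s≤s z≤n
    positive true middle = s≤s z≤n
    positive true high = s≤s z≤n
    positive false low = s≤s z≤n
    positive false middle = s≤s z≤n
    positive false high = s≤s z≤n
    below-block : ∀ a → a ≤ 5 → suc (a * m + mirror r) ≤ 6 * m
    below-block a a≤5 = ≤-trans (block-top a (mirror r) (mirror<m r<m)) (*-monoˡ-≤ m (s≤s a≤5))
    low≤ : ∀ r x m → suc (r + x) ≡ m → suc (suc (r + r)) ≤ 6 * m
    low≤ r x .(suc (r + x)) refl = ≤+⇒≤ _ (4 * r + 6 * x + 4) _ (solve (r ∷ x ∷ []))
    bounded : ∀ s σ → baseValue s r σ ≤ 6 * m
    bounded true low = ≤-trans (n≤1+n _) (low≤ r (mirror r) m (mirror-sum r<m))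
    bounded false low = low≤ r (mirror r) m (mirror-sum r<m)
    bounded true middle = below-block 2 (s≤s (s≤s z≤n))
    bounded false middle = below-block 3 (s≤s (s≤s (s≤s z≤n)))
    bounded false high = below-block 4 (s≤s (s≤s (s≤s (s≤s z≤n))))
    bounded true high = below-block 5 ≤-refl

-- For m = 2h the first h rows are crossed: column 0 collects the pairs high+low of the first half
-- and low+high of the second half, column 1 the opposite, column 2 the middle pairs.
evenArrangement : ℕ → ℕ → Arrangement
evenArrangement h r = if r <ᵇ h then HLM else LHM

module EvenColumns (h : ℕ) where
  open BaseArray (h + h) (evenArrangement h)

  sum-by-arrangement : (F : Arrangement → ℕ → ℕ) →
    sumBelow (h + h) (λ r → F (evenArrangement h r) r) ≡ sumBelow h (F HLM) + sumBelow h (λ i → F LHM (h + i))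
  sum-by-arrangement F = trans (sumBelow-split h h (λ r → F (evenArrangement h r) r))
    (cong₂ _+_ (sumBelow-cong h (λ r r<h → cong (λ a → F a r) (front r<h)))
               (sumBelow-cong h (λ i _ → cong (λ a → F a (h + i)) (back i))))
    where
    front : ∀ {r} → r < h → evenArrangement h r ≡ HLM
    front r<h rewrite <⇒<ᵇ≡true r<h = refl
    back : ∀ i → evenArrangement h (h + i) ≡ LHM
    back i rewrite ≥⇒<ᵇ≡false (m≤m+n h i) = refl

  sum-linear-halves : ∀ a b (f g : ℕ → ℕ) → (∀ r → r < h → f r ≡ a + r) → (∀ i → i < h → g (h + i) ≡ b + (h + i)) →
    sumBelow h f + sumBelow h (λ i → g (h + i)) ≡ (h * a + h * (b + h)) + 2 * tri h
  sum-linear-halves a b f g f≡ g≡ = begin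
    sumBelow h f + sumBelow h (λ i → g (h + i))
      ≡⟨ cong₂ _+_ (trans (sumBelow-cong h f≡) (sumBelow-shift h a))
                   (trans (sumBelow-cong h (λ i i<h → trans (g≡ i i<h) (sym (+-assoc b h i)))) (sumBelow-shift h (b + h))) ⟩
    (h * a + tri h) + (h * (b + h) + tri h)
      ≡⟨ regroup (h * a) (h * (b + h)) (tri h) ⟩
    (h * a + h * (b + h)) + 2 * tri h ∎
    where
    open ≡-Reasoning
    regroup : ∀ A B t → (A + t) + (B + t) ≡ (A + B) + 2 * t
    regroup = solve-∀

  columns-balanced : ColumnsBalanced
  columns-balanced = every-column column₀ column₁ column₂
    where
    front<m : ∀ {r} → r < h → r < h + h
    front<m r<h = ≤-trans r<h (m≤m+n h h)
    back<m : ∀ {i} → i < h → h + i < h + h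
    back<m i<h = +-monoʳ-< h i<h
    column₀ : sumBelow (h + h) (λ r → baseEntry true r 0 + baseEntry false r 0) ≡ columnSum (h + h) 3
    column₀ = trans (sum-by-arrangement (pairInColumn 0))
      (trans (sum-linear-halves (6 * (h + h) + 2) (5 * (h + h) + 1) (pairInColumn 0 HLM) (pairInColumn 0 LHM)
                (λ r r<h → high+low≡ r (front<m r<h)) (λ i i<h → low+high≡ (h + i) (back<m i<h)))
             (close-with-tri (h * (6 * (h + h) + 2) + h * ((5 * (h + h) + 1) + h)) ((h + h) * suc (2 * ((h + h) * 3)))
                (tri h) h (solve (h ∷ [])) (2*tri+n≡n*n h)))
    column₁ : sumBelow (h + h) (λ r → baseEntry true r 1 + baseEntry false r 1) ≡ columnSum (h + h) 3
    column₁ = trans (sum-by-arrangement (pairInColumn 1))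
      (trans (sum-linear-halves (5 * (h + h) + 1) (6 * (h + h) + 2) (pairInColumn 1 HLM) (pairInColumn 1 LHM)
                (λ r r<h → low+high≡ r (front<m r<h)) (λ i i<h → high+low≡ (h + i) (back<m i<h)))
             (close-with-tri (h * (5 * (h + h) + 1) + h * ((6 * (h + h) + 2) + h)) ((h + h) * suc (2 * ((h + h) * 3)))
                (tri h) h (solve (h ∷ [])) (2*tri+n≡n*n h)))
    column₂ : sumBelow (h + h) (λ r → baseEntry true r 2 + baseEntry false r 2) ≡ columnSum (h + h) 3
    column₂ = trans (sumBelow-cong (h + h) (λ r _ → middle-column r)) sum-middlePair
      where
      middle-column : ∀ r → baseEntry true r 2 + baseEntry false r 2 ≡ middlePair r
      middle-column r with r <ᵇ h
      ... | true = refl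
      ... | false = refl

  columns-half-above : ColumnsHalfAbove
  columns-half-above c c<3 = trans
    (sumBelow-cong (h + h) (λ r r<m → trans
      (cong₂ _+_ (isAbove-baseValue true r (slotAt true (evenArrangement h r) c) r<m)
                 (isAbove-baseValue false r (slotAt false (evenArrangement h r) c) r<m))
      (one-above c r c<3)))
    (trans (sumBelow-const (h + h) 1) (*-identityʳ _))
    where
    one-above : ∀ c r → c < 3 →
      aboveSlot true (slotAt true (evenArrangement h r) c) + aboveSlot false (slotAt false (evenArrangement h r) c) ≡ 1
    one-above c r with r <ᵇ h
    ... | true = every-column {P = λ c → aboveSlot true (slotAt true HLM c) + aboveSlot false (slotAt false HLM c) ≡ 1}
                   refl refl refl c
    ... | false = every-column {P = λ c → aboveSlot true (slotAt true LHM c) + aboveSlot false (slotAt false LHM c) ≡ 1}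
                    refl refl refl c

oddTail : ℕ → Arrangement
oddTail 0 = MHL
oddTail 1 = LMH
oddTail (suc (suc _)) = LHM

-- For m = 2h + 1 the first h rows are crossed as in the even case, and rows h and h + 1 use the
-- two remaining arrangements to even out the columns.
oddArrangement : ℕ → ℕ → Arrangement
oddArrangement h r = if r <ᵇ h then HLM else oddTail (r ∸ h)

module OddColumns (h′ : ℕ) where
  h : ℕ
  h = suc h′

  open BaseArray (h + suc h) (oddArrangement h)

  sum-by-arrangement : (F : Arrangement → ℕ → ℕ) → sumBelow (h + suc h) (λ r → F (oddArrangement h r) r) ≡
    sumBelow h (F HLM) + (F MHL h + (F LMH (suc h) + sumBelow h′ (λ i → F LHM (h + suc (suc i)))))
  sum-by-arrangement F = trans (sumBelow-split h (suc h) (λ r → F (oddArrangement h r) r))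
    (cong₂ _+_ (sumBelow-cong h (λ r r<h → cong (λ a → F a r) (front r<h)))
      (trans (sumBelow-cong (suc h) (λ i _ → cong (λ a → F a (h + i)) (back i)))
        (cong₂ (λ x y → F MHL x + (F LMH y + sumBelow h′ (λ i → F LHM (h + suc (suc i)))))
               (+-identityʳ h) (trans (+-suc h 0) (cong suc (+-identityʳ h))))))
    where
    front : ∀ {r} → r < h → oddArrangement h r ≡ HLM
    front r<h rewrite <⇒<ᵇ≡true r<h = refl
    back : ∀ i → oddArrangement h (h + i) ≡ oddTail i
    back i rewrite ≥⇒<ᵇ≡false (m≤m+n h i) | m+n∸m≡n h i = refl

  mirror-h : mirror h ≡ h
  mirror-h = m+n∸n≡m h (suc h)

  mirror-suc-h : mirror (suc h) ≡ h′
  mirror-suc-h = m+n∸n≡m h′ (suc (suc h′))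

  sum-front : ∀ a (f : ℕ → ℕ) → (∀ r → r < h → f r ≡ a + r) → sumBelow h f ≡ h * a + (h′ + tri h′)
  sum-front a f f≡ = trans (sumBelow-cong h f≡) (trans (sumBelow-shift h a) (cong (h * a +_) (tri-suc h′)))

  sum-back : ∀ a (f : ℕ → ℕ) → (∀ i → i < h′ → f (h + suc (suc i)) ≡ a + (h + suc (suc i))) →
             sumBelow h′ (λ i → f (h + suc (suc i))) ≡ h′ * (a + h + 2) + tri h′
  sum-back a f f≡ = trans (sumBelow-cong h′ (λ i i<h′ → trans (f≡ i i<h′) (shuffle a h i))) (sumBelow-shift h′ (a + h + 2))
    where
    shuffle : ∀ a b i → a + (b + suc (suc i)) ≡ (a + b + 2) + i
    shuffle = solve-∀

  private
    front<m : ∀ {r} → r < h → r < h + suc h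
    front<m r<h = ≤-trans r<h (m≤m+n h (suc h))
    back<m : ∀ {i} → i < h′ → h + suc (suc i) < h + suc h
    back<m i<h′ = +-monoʳ-< h (s≤s (s≤s i<h′))
    close-with-tri′ : ∀ E N t n → E + n * n ≡ N + n + 2 * t → 2 * t + n ≡ n * n → E ≡ N
    close-with-tri′ E N t n eq tri-eq = +-cancelʳ-≡ (n * n) E N
      (trans eq (trans (+-assoc N n (2 * t)) (cong (N +_) (trans (+-comm n (2 * t)) tri-eq))))

  column₀ : sumBelow (h + suc h) (λ r → baseEntry true r 0 + baseEntry false r 0) ≡ columnSum (h + suc h) 3
  column₀ = trans (sum-by-arrangement (pairInColumn 0))
    (trans (cong₂ _+_ (sum-front (6 * (h + suc h) + 2) (pairInColumn 0 HLM) (λ r r<h → high+low≡ r (front<m r<h)))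
             (cong₂ _+_ (cong (λ x → suc (2 * (h + suc h) + x) + suc (4 * (h + suc h) + x)) mirror-h)
               (cong₂ _+_ (cong (λ x → suc (suc h + suc h) + suc (3 * (h + suc h) + x)) mirror-suc-h)
                 (sum-back (5 * (h + suc h) + 1) (pairInColumn 0 LHM) (λ i i<h′ → low+high≡ _ (back<m i<h′))))))
      (close h′ (tri h′) (2*tri+n≡n*n h′)))
    where
    close : ∀ h′ t → 2 * t + h′ ≡ h′ * h′ →
      (suc h′ * (6 * (suc h′ + suc (suc h′)) + 2) + (h′ + t)) +
      ((suc (2 * (suc h′ + suc (suc h′)) + suc h′) + suc (4 * (suc h′ + suc (suc h′)) + suc h′)) +
       ((suc (suc (suc h′) + suc (suc h′)) + suc (3 * (suc h′ + suc (suc h′)) + h′)) +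
        (h′ * (5 * (suc h′ + suc (suc h′)) + 1 + suc h′ + 2) + t)))
      ≡ (suc h′ + suc (suc h′)) * suc (2 * ((suc h′ + suc (suc h′)) * 3))
    close h′ t eq = close-with-tri′ _ _ t h′ (solve (h′ ∷ t ∷ [])) eq

  column₁ : sumBelow (h + suc h) (λ r → baseEntry true r 1 + baseEntry false r 1) ≡ columnSum (h + suc h) 3
  column₁ = trans (sum-by-arrangement (pairInColumn 1))
    (trans (cong₂ _+_ (sum-front (5 * (h + suc h) + 1) (pairInColumn 1 HLM) (λ r r<h → low+high≡ r (front<m r<h)))
             (cong₂ _+_ (cong (λ x → suc (5 * (h + suc h) + x) + suc (3 * (h + suc h) + x)) mirror-h)
               (cong₂ _+_ (cong (λ x → suc (2 * (h + suc h) + x) + suc (suc (suc h + suc h))) mirror-suc-h)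
                 (sum-back (6 * (h + suc h) + 2) (pairInColumn 1 LHM) (λ i i<h′ → high+low≡ _ (back<m i<h′))))))
      (close h′ (tri h′) (2*tri+n≡n*n h′)))
    where
    close : ∀ h′ t → 2 * t + h′ ≡ h′ * h′ →
      (suc h′ * (5 * (suc h′ + suc (suc h′)) + 1) + (h′ + t)) +
      ((suc (5 * (suc h′ + suc (suc h′)) + suc h′) + suc (3 * (suc h′ + suc (suc h′)) + suc h′)) +
       ((suc (2 * (suc h′ + suc (suc h′)) + h′) + suc (suc (suc (suc h′) + suc (suc h′)))) +
        (h′ * (6 * (suc h′ + suc (suc h′)) + 2 + suc h′ + 2) + t)))
      ≡ (suc h′ + suc (suc h′)) * suc (2 * ((suc h′ + suc (suc h′)) * 3))
    close h′ t eq = close-with-tri′ _ _ t h′ (solve (h′ ∷ t ∷ [])) eq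

  -- In rows h and h + 1 column 2 holds other slots, but their four values add up to two middle pairs.
  column₂ : sumBelow (h + suc h) (λ r → baseEntry true r 2 + baseEntry false r 2) ≡ columnSum (h + suc h) 3
  column₂ = trans (sum-by-arrangement (pairInColumn 2))
    (trans (cong (sumBelow h middlePair +_)
       (trans (cong (λ x → suc (h + h) + suc (suc (h + h)) +
                      ((suc (5 * (h + suc h) + x) + suc (4 * (h + suc h) + x)) + Rest)) mirror-suc-h)
        (trans (swap-middle h′ Rest)
          (sym (cong₂ (λ x y → suc (2 * (h + suc h) + x) + suc (3 * (h + suc h) + x) +
                      ((suc (2 * (h + suc h) + y) + suc (3 * (h + suc h) + y)) + Rest)) mirror-h mirror-suc-h)))))
     (trans (sym (sum-by-arrangement (λ _ r → middlePair r))) sum-middlePair))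
    where
    Rest : ℕ
    Rest = sumBelow h′ (λ i → middlePair (h + suc (suc i)))
    swap-middle : ∀ h′ X →
      (suc (suc h′ + suc h′) + suc (suc (suc h′ + suc h′))) +
      ((suc (5 * (suc h′ + suc (suc h′)) + h′) + suc (4 * (suc h′ + suc (suc h′)) + h′)) + X)
      ≡ (suc (2 * (suc h′ + suc (suc h′)) + suc h′) + suc (3 * (suc h′ + suc (suc h′)) + suc h′)) +
        ((suc (2 * (suc h′ + suc (suc h′)) + h′) + suc (3 * (suc h′ + suc (suc h′)) + h′)) + X)
    swap-middle = solve-∀

  columns-balanced : ColumnsBalanced
  columns-balanced = every-column column₀ column₁ column₂

  columns-half-above : ColumnsHalfAbove
  columns-half-above c c<3 = trans
    (sumBelow-cong (h + suc h) (λ r r<m →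
      cong₂ _+_ (isAbove-baseValue true r (slotAt true (oddArrangement h r) c) r<m)
                (isAbove-baseValue false r (slotAt false (oddArrangement h r) c) r<m)))
    (trans (sum-by-arrangement (λ a _ → aboveInColumn c a)) (count-above c c<3))
    where
    aboveInColumn : ℕ → Arrangement → ℕ
    aboveInColumn c a = aboveSlot true (slotAt true a c) + aboveSlot false (slotAt false a c)
    count-above : ∀ c → c < 3 → sumBelow h (λ _ → aboveInColumn c HLM) +
      (aboveInColumn c MHL + (aboveInColumn c LMH + sumBelow h′ (λ _ → aboveInColumn c LHM))) ≡ h + suc h
    count-above 0 _ rewrite sumBelow-const h 1 | sumBelow-const h′ 1 = solve (h′ ∷ [])
    count-above 1 _ rewrite sumBelow-const h 1 | sumBelow-const h′ 1 = solve (h′ ∷ [])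
    count-above 2 _ rewrite sumBelow-const h 1 | sumBelow-const h′ 1 = solve (h′ ∷ [])
    count-above (suc (suc (suc c))) (s≤s (s≤s (s≤s ())))

even-or-odd : ∀ m → Σ ℕ λ h → (m ≡ h + h) ⊎ (m ≡ suc (h + h))
even-or-odd zero = 0 , inj₁ refl
even-or-odd (suc m) with even-or-odd m
... | h , inj₁ m≡ = h , inj₂ (cong suc m≡)
... | h , inj₂ m≡ = suc h , inj₁ (trans (cong suc m≡) (cong suc (sym (+-suc h h))))

balanced-arrangement : ∀ m → 2 ≤ m →
  Σ (ℕ → Arrangement) λ a → BaseArray.ColumnsBalanced m a × BaseArray.ColumnsHalfAbove m a
balanced-arrangement m 2≤m with even-or-odd m
... | h , inj₁ refl = evenArrangement h , EvenColumns.columns-balanced h , EvenColumns.columns-half-above h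
... | zero , inj₂ refl with s≤s () ← 2≤m
... | suc h′ , inj₂ m≡ rewrite trans m≡ (cong suc (sym (+-suc h′ (suc h′)))) =
  oddArrangement (suc h′) , OddColumns.columns-balanced h′ , OddColumns.columns-half-above h′

width : ℕ → ℕ
width zero = 3
width (suc j) = width j + 2

width≡2j+3 : ∀ j → width j ≡ 2 * suc j + 1
width≡2j+3 zero = refl
width≡2j+3 (suc j) = trans (cong (_+ 2) (width≡2j+3 j)) (expand j)
  where
  expand : ∀ j → 2 * suc j + 1 + 2 ≡ 2 * suc (suc j) + 1
  expand = solve-∀

-- Which side receives the two new entries above the threshold at step j; it alternates.
highAt : ℕ → Bool
highAt zero = true
highAt (suc j) = not (highAt j)

getsHigh : ℕ → Bool → Bool
getsHigh j s = if s then highAt j else not (highAt j)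

getsHigh-suc : ∀ j s → getsHigh (suc j) s ≡ not (getsHigh j s)
getsHigh-suc j true = refl
getsHigh-suc j false = refl

getsHigh-highAt : ∀ j → getsHigh j (highAt j) ≡ true
getsHigh-highAt j with highAt j
... | true = refl
... | false = refl

getsHigh-not-highAt : ∀ j → getsHigh j (not (highAt j)) ≡ false
getsHigh-not-highAt j with highAt j
... | true = refl
... | false = refl

side-of-getsHigh : ∀ j s → (if getsHigh j s then highAt j else not (highAt j)) ≡ s
side-of-getsHigh j true with highAt j
... | true = refl
... | false = refl
side-of-getsHigh j false with highAt j
... | true = refl
... | false = refl

data ColumnAt (j : ℕ) : ℕ → Set where
  old : ∀ {c} → c < width j → ColumnAt j c
  new : ∀ {i} → i < 2 → ColumnAt j (width j + i)

columnAt : ∀ j {c} → c < width (suc j) → ColumnAt j c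
columnAt j {c} c<w with c <? width j
... | yes c<w′ = old c<w′
... | no c≮w′ = subst (ColumnAt j) (m+[n∸m]≡n (≮⇒≥ c≮w′))
  (new (+-cancelˡ-< (width j) _ _ (subst (_< width j + 2) (sym (m+[n∸m]≡n (≮⇒≥ c≮w′))) c<w)))

-- At step j the array has width j columns and its entries enumerate [1, 2 m · width j]; an entry is
-- high if it exceeds half j = m · width j. Step j + 1 adds 4m to the high entries and fills the gap
-- with two new columns: each pair of rows of rank r gets one high and one low pair of new entries.
module Extension (m : ℕ) (arrangement : ℕ → Arrangement)
  (balanced : BaseArray.ColumnsBalanced m arrangement) (halfAbove : BaseArray.ColumnsHalfAbove m arrangement) where

  open BaseArray m arrangement

  half : ℕ → ℕ
  half j = m * width j

  size : ℕ → ℕ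
  size j = 2 * half j

  half-suc : ∀ j → half (suc j) ≡ half j + 2 * m
  half-suc j = trans (*-distribˡ-+ m (width j) 2) (cong (half j +_) (*-comm m 2))

  shift : ℕ → ℕ → ℕ
  shift j x = x + 4 * m * isAbove (half j) x

  newPair : Bool → ℕ → ℕ → ℕ → ℕ
  newPair true j r zero = suc (half j + 3 * m + mirror r)
  newPair true j r (suc _) = suc (half j + 2 * m + r)
  newPair false j r zero = suc (half j + r)
  newPair false j r (suc _) = suc (half j + m + mirror r)

  newEntry : ℕ → Bool → ℕ → ℕ → ℕ
  newEntry j s r i = newPair (getsHigh j s) j r i

  entry : ℕ → Bool → ℕ → ℕ → ℕ
  entry zero s r c = baseEntry s r c
  entry (suc j) s r c = if c <ᵇ width j then shift j (entry j s r c) else newEntry j s r (c ∸ width j)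

  entry-old : ∀ j s r c → c < width j → entry (suc j) s r c ≡ shift j (entry j s r c)
  entry-old j s r c c<w rewrite <⇒<ᵇ≡true c<w = refl

  entry-new : ∀ j s r i → entry (suc j) s r (width j + i) ≡ newEntry j s r i
  entry-new j s r i rewrite ≥⇒<ᵇ≡false (m≤m+n (width j) i) | m+n∸m≡n (width j) i = refl

  shift-above : ∀ j {y} → half j < y → shift j y ≡ y + 4 * m
  shift-above j {y} M<y rewrite >⇒isAbove≡1 M<y = cong (y +_) (*-identityʳ (4 * m))

  shift-below : ∀ j {y} → y ≤ half j → shift j y ≡ y
  shift-below j {y} y≤M rewrite ≤⇒isAbove≡0 y≤M = trans (cong (y +_) (*-zeroʳ (4 * m))) (+-identityʳ y)

  sum-shift : ∀ n j (f : ℕ → ℕ) →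
    sumBelow n (λ c → shift j (f c)) ≡ sumBelow n f + 4 * m * sumBelow n (λ c → isAbove (half j) (f c))
  sum-shift n j f = trans (sumBelow-+ n f (λ c → 4 * m * isAbove (half j) (f c)))
                          (cong (sumBelow n f +_) (sumBelow-* n (4 * m) (λ c → isAbove (half j) (f c))))

  shift-pair : ∀ j a b → shift j a + shift j b ≡ (a + b) + 4 * m * (isAbove (half j) a + isAbove (half j) b)
  shift-pair j a b = regroup a b (isAbove (half j) a) (isAbove (half j) b) m
    where
    regroup : ∀ a b x y k → (a + 4 * k * x) + (b + 4 * k * y) ≡ (a + b) + 4 * k * (x + y)
    regroup = solve-∀

  isAbove-next≡1 : ∀ j {x} → half j + 2 * m < x → isAbove (half (suc j)) x ≡ 1
  isAbove-next≡1 j {x} lt = >⇒isAbove≡1 (subst (_< x) (sym (half-suc j)) lt)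

  isAbove-next≡0 : ∀ j {x} → x ≤ half j + 2 * m → isAbove (half (suc j)) x ≡ 0
  isAbove-next≡0 j {x} le = ≤⇒isAbove≡0 (subst (x ≤_) (sym (half-suc j)) le)

  isAbove-shift : ∀ j x → isAbove (half (suc j)) (shift j x) ≡ isAbove (half j) x
  isAbove-shift j x with half j <? x
  ... | yes M<x rewrite shift-above j M<x | >⇒isAbove≡1 M<x =
    isAbove-next≡1 j (<-≤-trans (+-monoˡ-< (2 * m) M<x) (+-monoʳ-≤ x (*-monoˡ-≤ m {2} {4} (s≤s (s≤s z≤n)))))
  ... | no M≮x rewrite shift-below j (≮⇒≥ M≮x) | ≤⇒isAbove≡0 (≮⇒≥ M≮x) =
    isAbove-next≡0 j (≤-trans (≮⇒≥ M≮x) (m≤m+n (half j) (2 * m)))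

  isAbove-newPair : ∀ b j r i → r < m → i < 2 → isAbove (half (suc j)) (newPair b j r i) ≡ 𝟙 b
  isAbove-newPair true j r 0 _ _ =
    isAbove-next≡1 j (s≤s (≤+⇒≤ (half j + 2 * m) (m + mirror r) _ (expand (half j) m (mirror r))))
    where
    expand : ∀ M m x → M + 2 * m + (m + x) ≡ M + 3 * m + x
    expand = solve-∀
  isAbove-newPair true j r 1 _ _ = isAbove-next≡1 j (s≤s (m≤m+n _ r))
  isAbove-newPair false j r 0 r<m _ =
    isAbove-next≡0 j (subst (_≤ half j + 2 * m) (+-suc (half j) r) (+-monoʳ-≤ (half j) (≤-trans r<m (m≤m+n m (m + 0)))))
  isAbove-newPair false j r 1 r<m _ =
    isAbove-next≡0 j (subst₂ _≤_ (+-suc (half j + m) (mirror r)) (regroup (half j) m) (+-monoʳ-≤ (half j + m) (mirror<m r<m)))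
    where
    regroup : ∀ M m → M + m + m ≡ M + 2 * m
    regroup = solve-∀
  isAbove-newPair b j r (suc (suc i)) _ (s≤s (s≤s ()))

  isAbove-newEntry : ∀ j s r i → r < m → i < 2 → isAbove (half (suc j)) (newEntry j s r i) ≡ 𝟙 (getsHigh j s)
  isAbove-newEntry j s r i = isAbove-newPair (getsHigh j s) j r i

  row-above : ∀ j s r → r < m →
    sumBelow (width j) (λ c → isAbove (half j) (entry j s r c)) ≡ suc j + 𝟙 (not (getsHigh j s))
  row-above zero true r r<m = base-row-above true r r<m
  row-above zero false r r<m = base-row-above false r r<m
  row-above (suc j) s r r<m = begin
    sumBelow (width j + 2) (λ c → isAbove (half (suc j)) (entry (suc j) s r c))
      ≡⟨ sumBelow-split (width j) 2 (λ c → isAbove (half (suc j)) (entry (suc j) s r c)) ⟩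
    sumBelow (width j) (λ c → isAbove (half (suc j)) (entry (suc j) s r c))
      + sumBelow 2 (λ i → isAbove (half (suc j)) (entry (suc j) s r (width j + i)))
      ≡⟨ cong₂ _+_ (sumBelow-cong (width j) (λ c c<w → trans (cong (isAbove (half (suc j))) (entry-old j s r c c<w))
                                                            (isAbove-shift j (entry j s r c))))
                   (sumBelow-cong 2 (λ i i<2 → trans (cong (isAbove (half (suc j))) (entry-new j s r i))
                                                      (isAbove-newEntry j s r i r<m i<2))) ⟩
    sumBelow (width j) (λ c → isAbove (half j) (entry j s r c)) + sumBelow 2 (λ _ → 𝟙 (getsHigh j s))
      ≡⟨ cong (_+ sumBelow 2 (λ _ → 𝟙 (getsHigh j s))) (row-above j s r r<m) ⟩
    suc j + 𝟙 (not (getsHigh j s)) + (𝟙 (getsHigh j s) + (𝟙 (getsHigh j s) + 0))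
      ≡⟨ tally (getsHigh j s) ⟩
    suc (suc j) + 𝟙 (not (not (getsHigh j s)))
      ≡⟨ cong (λ b → suc (suc j) + 𝟙 (not b)) (sym (getsHigh-suc j s)) ⟩
    suc (suc j) + 𝟙 (not (getsHigh (suc j) s)) ∎
    where
    open ≡-Reasoning
    tally : ∀ b → suc j + 𝟙 (not b) + (𝟙 b + (𝟙 b + 0)) ≡ suc (suc j) + 𝟙 (not (not b))
    tally true = solve (j ∷ [])
    tally false = solve (j ∷ [])

  row-sum : ∀ j s r → r < m → sumBelow (width j) (entry j s r) ≡ 𝟙 (not s) + rowSum m (suc j) (width j)
  row-sum zero s r r<m = base-row-sum s r r<m
  row-sum (suc j) s r r<m = begin
    sumBelow (width j + 2) (entry (suc j) s r)
      ≡⟨ sumBelow-split (width j) 2 (entry (suc j) s r) ⟩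
    sumBelow (width j) (entry (suc j) s r) + sumBelow 2 (λ i → entry (suc j) s r (width j + i))
      ≡⟨ cong₂ _+_ (sumBelow-cong (width j) (entry-old j s r)) (sumBelow-cong 2 (λ i _ → entry-new j s r i)) ⟩
    sumBelow (width j) (λ c → shift j (entry j s r c)) + (newEntry j s r 0 + (newEntry j s r 1 + 0))
      ≡⟨ cong (_+ (newEntry j s r 0 + (newEntry j s r 1 + 0)))
              (trans (sum-shift (width j) j (entry j s r)) (cong₂ (λ a b → a + 4 * m * b) (row-sum j s r r<m) (row-above j s r r<m))) ⟩
    (𝟙 (not s) + rowSum m (suc j) (width j) + 4 * m * (suc j + 𝟙 (not (getsHigh j s))))
      + (newEntry j s r 0 + (newEntry j s r 1 + 0))
      ≡⟨ by-kind (getsHigh j s) ⟩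
    𝟙 (not s) + rowSum m (suc (suc j)) (width (suc j)) ∎
    where
    open ≡-Reasoning
    high-pair : ∀ e j W r x m → suc (r + x) ≡ m →
      (e + (suc j * suc (2 * (m * W)) + m * W) + 4 * m * (suc j + 0))
        + (suc (m * W + 3 * m + x) + (suc (m * W + 2 * m + r) + 0))
      ≡ e + (suc (suc j) * suc (2 * (m * (W + 2))) + m * (W + 2))
    high-pair e j W r x .(suc (r + x)) refl = solve (e ∷ j ∷ W ∷ r ∷ x ∷ [])
    low-pair : ∀ e j W r x m → suc (r + x) ≡ m →
      (e + (suc j * suc (2 * (m * W)) + m * W) + 4 * m * (suc j + 1))
        + (suc (m * W + r) + (suc (m * W + m + x) + 0))
      ≡ e + (suc (suc j) * suc (2 * (m * (W + 2))) + m * (W + 2))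
    low-pair e j W r x .(suc (r + x)) refl = solve (e ∷ j ∷ W ∷ r ∷ x ∷ [])
    by-kind : ∀ b → (𝟙 (not s) + rowSum m (suc j) (width j) + 4 * m * (suc j + 𝟙 (not b)))
                      + (newPair b j r 0 + (newPair b j r 1 + 0))
                    ≡ 𝟙 (not s) + rowSum m (suc (suc j)) (width (suc j))
    by-kind true = high-pair (𝟙 (not s)) j (width j) r (mirror r) m (mirror-sum r<m)
    by-kind false = low-pair (𝟙 (not s)) j (width j) r (mirror r) m (mirror-sum r<m)

  newPair-complement : ∀ b j r i → r < m → i < 2 → newPair b j r i + newPair (not b) j r i ≡ suc (size (suc j))
  newPair-complement b j r i r<m = by-kind b i
    where
    first : ∀ W r x m → suc (r + x) ≡ m → suc (m * W + 3 * m + x) + suc (m * W + r) ≡ suc (2 * (m * (W + 2)))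
    first W r x .(suc (r + x)) refl = solve (W ∷ r ∷ x ∷ [])
    second : ∀ W r x m → suc (r + x) ≡ m → suc (m * W + 2 * m + r) + suc (m * W + m + x) ≡ suc (2 * (m * (W + 2)))
    second W r x .(suc (r + x)) refl = solve (W ∷ r ∷ x ∷ [])
    by-kind : ∀ b i → i < 2 → newPair b j r i + newPair (not b) j r i ≡ suc (size (suc j))
    by-kind true 0 _ = first (width j) r (mirror r) m (mirror-sum r<m)
    by-kind false 0 _ = trans (+-comm (suc (half j + r)) _) (first (width j) r (mirror r) m (mirror-sum r<m))
    by-kind true 1 _ = second (width j) r (mirror r) m (mirror-sum r<m)
    by-kind false 1 _ = trans (+-comm (suc (half j + m + mirror r)) _) (second (width j) r (mirror r) m (mirror-sum r<m))
    by-kind b (suc (suc i)) (s≤s (s≤s ()))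

  aboveInPair : ℕ → ℕ → ℕ → ℕ
  aboveInPair j c r = isAbove (half j) (entry j true r c) + isAbove (half j) (entry j false r c)

  column-sum : ∀ j c → c < width j → sumBelow m (λ r → entry j true r c + entry j false r c) ≡ columnSum m (width j)
  column-above : ∀ j c → c < width j → sumBelow m (aboveInPair j c) ≡ m

  column-sum zero c c<3 = balanced c c<3
  column-sum (suc j) c c<w with columnAt j c<w
  ... | old c<w′ = begin
    sumBelow m (λ r → entry (suc j) true r c + entry (suc j) false r c)
      ≡⟨ sumBelow-cong m (λ r _ → trans (cong₂ _+_ (entry-old j true r c c<w′) (entry-old j false r c c<w′))
                                        (shift-pair j (entry j true r c) (entry j false r c))) ⟩
    sumBelow m (λ r → (entry j true r c + entry j false r c)
                      + 4 * m * (isAbove (half j) (entry j true r c) + isAbove (half j) (entry j false r c)))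
      ≡⟨ trans (sumBelow-+ m (λ r → entry j true r c + entry j false r c) (λ r → 4 * m * aboveInPair j c r))
               (cong (sumBelow m (λ r → entry j true r c + entry j false r c) +_) (sumBelow-* m (4 * m) (aboveInPair j c))) ⟩
    sumBelow m (λ r → entry j true r c + entry j false r c)
      + 4 * m * sumBelow m (λ r → isAbove (half j) (entry j true r c) + isAbove (half j) (entry j false r c))
      ≡⟨ cong₂ (λ a b → a + 4 * m * b) (column-sum j c c<w′) (column-above j c c<w′) ⟩
    columnSum m (width j) + 4 * m * m
      ≡⟨ step m (width j) ⟩
    columnSum m (width (suc j)) ∎
    where
    open ≡-Reasoning
    step : ∀ m W → m * suc (2 * (m * W)) + 4 * m * m ≡ m * suc (2 * (m * (W + 2)))
    step = solve-∀
  ... | new {i} i<2 =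
    trans (sumBelow-cong m (λ r r<m → trans (cong₂ _+_ (entry-new j true r i) (entry-new j false r i))
                                            (newPair-complement (highAt j) j r i r<m i<2)))
          (sumBelow-const m _)

  column-above zero c c<3 = halfAbove c c<3
  column-above (suc j) c c<w with columnAt j c<w
  ... | old c<w′ = trans
    (sumBelow-cong m (λ r _ → cong₂ _+_ (trans (cong (isAbove (half (suc j))) (entry-old j true r c c<w′)) (isAbove-shift j (entry j true r c)))
                                        (trans (cong (isAbove (half (suc j))) (entry-old j false r c c<w′)) (isAbove-shift j (entry j false r c)))))
    (column-above j c c<w′)
  ... | new {i} i<2 = trans
    (sumBelow-cong m (λ r r<m → trans
      (cong₂ _+_ (trans (cong (isAbove (half (suc j))) (entry-new j true r i)) (isAbove-newEntry j true r i r<m i<2))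
                 (trans (cong (isAbove (half (suc j))) (entry-new j false r i)) (isAbove-newEntry j false r i r<m i<2)))
      (one-of (highAt j))))
    (trans (sumBelow-const m 1) (*-identityʳ m))
    where
    one-of : ∀ b → 𝟙 b + 𝟙 (not b) ≡ 1
    one-of true = refl
    one-of false = refl

  newPair≤ : ∀ j a x → a ≤ 3 → x < m → suc (half j + a * m + x) ≤ half j + 4 * m
  newPair≤ j a x a≤3 x<m = ≤-trans (subst (_≤ half j + a * m + m) (+-suc (half j + a * m) x) (+-monoʳ-≤ (half j + a * m) x<m))
    (≤-trans (≤-reflexive (trans (+-assoc (half j) (a * m) m) (cong (half j +_) (+-comm (a * m) m))))
             (+-monoʳ-≤ (half j) (*-monoˡ-≤ m (s≤s a≤3))))

  entry-bounds : ∀ j s r c → r < m → c < width j → 1 ≤ entry j s r c × entry j s r c ≤ size j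
  entry-bounds zero s r c r<m _ = baseValue-bounds s r (slotAt s (arrangement r) c) r<m
  entry-bounds (suc j) s r c r<m c<w with columnAt j c<w
  ... | old c<w′ rewrite entry-old j s r c c<w′ = ≤-trans (proj₁ bounds) (m≤m+n _ _) , shifted≤
    where
    bounds : 1 ≤ entry j s r c × entry j s r c ≤ size j
    bounds = entry-bounds j s r c r<m c<w′
    size-suc : ∀ m W → 2 * (m * W) + 4 * m ≡ 2 * (m * (W + 2))
    size-suc = solve-∀
    shifted≤ : shift j (entry j s r c) ≤ size (suc j)
    shifted≤ with half j <? entry j s r c
    ... | yes M< rewrite shift-above j M< = ≤-trans (+-monoˡ-≤ (4 * m) (proj₂ bounds)) (≤-reflexive (size-suc m (width j)))
    ... | no M≮ rewrite shift-below j (≮⇒≥ M≮) = ≤-trans (proj₂ bounds) (≤+⇒≤ _ (4 * m) _ (size-suc m (width j)))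
  ... | new {i} i<2 rewrite entry-new j s r i = new-bounds (getsHigh j s) i i<2
    where
    half+4m≤size : ∀ m W → m * W + 4 * m ≤ 2 * (m * (W + 2))
    half+4m≤size m W = ≤+⇒≤ _ (m * W) _ (expand m W)
      where
      expand : ∀ m W → m * W + 4 * m + m * W ≡ 2 * (m * (W + 2))
      expand = solve-∀
    within : ∀ a x → a ≤ 3 → x < m → suc (half j + a * m + x) ≤ size (suc j)
    within a x a≤3 x<m = ≤-trans (newPair≤ j a x a≤3 x<m) (half+4m≤size m (width j))
    new-bounds : ∀ b i → i < 2 → 1 ≤ newPair b j r i × newPair b j r i ≤ size (suc j)
    new-bounds true 0 _ = s≤s z≤n , within 3 (mirror r) (s≤s (s≤s (s≤s z≤n))) (mirror<m r<m)
    new-bounds true 1 _ = s≤s z≤n , within 2 r (s≤s (s≤s z≤n)) r<m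
    new-bounds false 0 _ = s≤s z≤n , subst (_≤ size (suc j)) (cong (λ z → suc (z + r)) (+-identityʳ (half j))) (within 0 r z≤n r<m)
    new-bounds false 1 _ = s≤s z≤n ,
      subst (_≤ size (suc j)) (cong (λ z → suc (half j + z + mirror r)) (*-identityˡ m)) (within 1 (mirror r) (s≤s z≤n) (mirror<m r<m))
    new-bounds b (suc (suc i)) (s≤s (s≤s ()))

  Position : Set
  Position = Bool × ℕ × ℕ

  decodeNew : ℕ → ℕ → Position
  decodeNew j x =
    if x <ᵇ m then (not (highAt j) , x , width j + 0)
    else if x <ᵇ 2 * m then (not (highAt j) , mirror (x ∸ m) , width j + 1)
    else if x <ᵇ 3 * m then (highAt j , x ∸ 2 * m , width j + 1)
    else (highAt j , mirror (x ∸ 3 * m) , width j + 0)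

  decode : ℕ → ℕ → Position
  decode zero v = let (s , r , σ) = baseDecode v in s , r , columnOf s (arrangement r) σ
  decode (suc j) v =
    if v ≤ᵇ half j then decode j v
    else if v ≤ᵇ half j + 4 * m then decodeNew j (v ∸ suc (half j))
    else decode j (v ∸ 4 * m)

  private
    suc-+-∸ : ∀ M a b → suc (M + a + b) ∸ suc M ≡ a + b
    suc-+-∸ M a b = trans (cong (_∸ M) (+-assoc M a b)) (m+n∸m≡n M (a + b))
    k*m≤ : ∀ k l x → k ≤ l → k * m ≤ l * m + x
    k*m≤ k l x k≤l = ≤-trans (*-monoˡ-≤ m k≤l) (m≤m+n (l * m) x)
    m≤ : ∀ l x → 1 ≤ l → m ≤ l * m + x
    m≤ l x 1≤l = subst (_≤ l * m + x) (*-identityˡ m) (k*m≤ 1 l x 1≤l)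
    m+x<2m : ∀ x y m → suc (x + y) ≡ m → m + x < 2 * m
    m+x<2m x y .(suc (x + y)) refl = s≤s (≤+⇒≤ _ y _ (solve (x ∷ y ∷ [])))
    2m+x<3m : ∀ x y m → suc (x + y) ≡ m → 2 * m + x < 3 * m
    2m+x<3m x y .(suc (x + y)) refl = s≤s (≤+⇒≤ _ y _ (solve (x ∷ y ∷ [])))

  decode-newPair : ∀ b j r i → r < m → i < 2 →
    decode (suc j) (newPair b j r i) ≡ ((if b then highAt j else not (highAt j)) , r , width j + i)
  decode-newPair true j r 0 r<m _
    rewrite >⇒≤ᵇ≡false {suc (half j + 3 * m + mirror r)} {half j} (s≤s (≤-trans (m≤m+n (half j) (3 * m)) (m≤m+n _ (mirror r))))
          | ≤⇒≤ᵇ≡true (newPair≤ j 3 (mirror r) ≤-refl (mirror<m r<m))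
          | suc-+-∸ (half j) (3 * m) (mirror r)
          | ≥⇒<ᵇ≡false (m≤ 3 (mirror r) (s≤s z≤n))
          | ≥⇒<ᵇ≡false (k*m≤ 2 3 (mirror r) (s≤s (s≤s z≤n)))
          | ≥⇒<ᵇ≡false (m≤m+n (3 * m) (mirror r))
          | m+n∸m≡n (3 * m) (mirror r) | mirror-involutive r<m = refl
  decode-newPair true j r 1 r<m _
    rewrite >⇒≤ᵇ≡false {suc (half j + 2 * m + r)} {half j} (s≤s (≤-trans (m≤m+n (half j) (2 * m)) (m≤m+n _ r)))
          | ≤⇒≤ᵇ≡true (newPair≤ j 2 r (s≤s (s≤s z≤n)) r<m)
          | suc-+-∸ (half j) (2 * m) r
          | ≥⇒<ᵇ≡false (m≤ 2 r (s≤s z≤n))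
          | ≥⇒<ᵇ≡false (m≤m+n (2 * m) r)
          | <⇒<ᵇ≡true (2m+x<3m r (mirror r) m (mirror-sum r<m))
          | m+n∸m≡n (2 * m) r = refl
  decode-newPair false j r 0 r<m _
    rewrite >⇒≤ᵇ≡false {suc (half j + r)} {half j} (s≤s (m≤m+n (half j) r))
          | ≤⇒≤ᵇ≡true (subst (_≤ half j + 4 * m) (cong suc (cong (_+ r) (+-identityʳ (half j)))) (newPair≤ j 0 r z≤n r<m))
          | m+n∸m≡n (half j) r
          | <⇒<ᵇ≡true r<m = refl
  decode-newPair false j r 1 r<m _
    rewrite >⇒≤ᵇ≡false {suc (half j + m + mirror r)} {half j} (s≤s (≤-trans (m≤m+n (half j) m) (m≤m+n _ (mirror r))))
          | ≤⇒≤ᵇ≡true (subst (_≤ half j + 4 * m) (cong suc (cong (λ z → half j + z + mirror r) (*-identityˡ m)))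
                                (newPair≤ j 1 (mirror r) (s≤s z≤n) (mirror<m r<m)))
          | suc-+-∸ (half j) m (mirror r)
          | ≥⇒<ᵇ≡false (m≤m+n m (mirror r))
          | <⇒<ᵇ≡true (m+x<2m (mirror r) r m (trans (cong suc (+-comm (mirror r) r)) (mirror-sum r<m)))
          | m+n∸m≡n m (mirror r) | mirror-involutive r<m = refl
  decode-newPair b j r (suc (suc i)) _ (s≤s (s≤s ()))

  decode-shift : ∀ j y {pos} → decode j y ≡ pos → decode (suc j) (shift j y) ≡ pos
  decode-shift j y decode≡ with half j <? y
  ... | yes M<y rewrite shift-above j M<y
                      | >⇒≤ᵇ≡false {y + 4 * m} {half j} (≤-trans M<y (m≤m+n y (4 * m)))
                      | >⇒≤ᵇ≡false {y + 4 * m} {half j + 4 * m} (+-monoˡ-< (4 * m) M<y)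
                      | m+n∸n≡m y (4 * m) = decode≡
  ... | no M≮y rewrite shift-below j (≮⇒≥ M≮y) | ≤⇒≤ᵇ≡true (≮⇒≥ M≮y) = decode≡

  decode-entry : ∀ j s r c → r < m → c < width j → decode j (entry j s r c) ≡ (s , r , c)
  decode-entry zero s r c r<m c<3
    rewrite baseDecode-baseValue s r (slotAt s (arrangement r) c) r<m | columnOf-slotAt s (arrangement r) c c<3 = refl
  decode-entry (suc j) s r c r<m c<w with columnAt j c<w
  ... | old c<w′ rewrite entry-old j s r c c<w′ = decode-shift j (entry j s r c) (decode-entry j s r c r<m c<w′)
  ... | new {i} i<2 rewrite entry-new j s r i =
    trans (decode-newPair (getsHigh j s) j r i r<m i<2) (cong (λ s → s , r , width j + i) (side-of-getsHigh j s))

  Decodes : ℕ → Position → ℕ → Set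
  Decodes j (s , r , c) v = r < m × c < width j × entry j s r c ≡ v

  private
    block< : ∀ a x → a ≤ x → x < a + m → x ∸ a < m
    block< a x lo hi = +-cancelˡ-< a _ _ (subst (_< a + m) (sym (m+[n∸m]≡n lo)) hi)
    2m≡ : 2 * m ≡ m + m
    2m≡ = cong (m +_) (+-identityʳ m)
    3m≡ : 3 * m ≡ 2 * m + m
    3m≡ = +-comm m (2 * m)
    4m≡ : 4 * m ≡ 3 * m + m
    4m≡ = +-comm m (3 * m)

  decodeNew-decodes : ∀ j x → x < 4 * m → Decodes (suc j) (decodeNew j x) (suc (half j + x))
  decodeNew-decodes j x x<4m with x <ᵇ m in lt₁
  ... | true = <ᵇ≡true⇒< lt₁ , +-monoʳ-< (width j) (s≤s z≤n) ,
               trans (entry-new j (not (highAt j)) x 0) (cong (λ b → newPair b j x 0) (getsHigh-not-highAt j))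
  ... | false with x <ᵇ 2 * m in lt₂
  ... | true = mirror<m y<m , +-monoʳ-< (width j) (s≤s (s≤s z≤n)) ,
        trans (entry-new j (not (highAt j)) (mirror (x ∸ m)) 1)
          (trans (cong (λ b → newPair b j (mirror (x ∸ m)) 1) (getsHigh-not-highAt j))
            (cong suc (trans (cong (half j + m +_) (mirror-involutive y<m))
                             (trans (+-assoc (half j) m _) (cong (half j +_) (m+[n∸m]≡n (<ᵇ≡false⇒≥ {x} {m} lt₁)))))))
    where
    y<m : x ∸ m < m
    y<m = block< m x (<ᵇ≡false⇒≥ lt₁) (subst (x <_) 2m≡ (<ᵇ≡true⇒< lt₂))
  ... | false with x <ᵇ 3 * m in lt₃
  ... | true = y<m , +-monoʳ-< (width j) (s≤s (s≤s z≤n)) ,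
        trans (entry-new j (highAt j) (x ∸ 2 * m) 1)
          (trans (cong (λ b → newPair b j (x ∸ 2 * m) 1) (getsHigh-highAt j))
            (cong suc (trans (+-assoc (half j) (2 * m) _) (cong (half j +_) (m+[n∸m]≡n (<ᵇ≡false⇒≥ {x} {2 * m} lt₂))))))
    where
    y<m : x ∸ 2 * m < m
    y<m = block< (2 * m) x (<ᵇ≡false⇒≥ lt₂) (subst (x <_) 3m≡ (<ᵇ≡true⇒< lt₃))
  ... | false = mirror<m y<m , +-monoʳ-< (width j) (s≤s z≤n) ,
        trans (entry-new j (highAt j) (mirror (x ∸ 3 * m)) 0)
          (trans (cong (λ b → newPair b j (mirror (x ∸ 3 * m)) 0) (getsHigh-highAt j))
            (cong suc (trans (cong (half j + 3 * m +_) (mirror-involutive y<m))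
                             (trans (+-assoc (half j) (3 * m) _) (cong (half j +_) (m+[n∸m]≡n (<ᵇ≡false⇒≥ {x} {3 * m} lt₃)))))))
    where
    y<m : x ∸ 3 * m < m
    y<m = block< (3 * m) x (<ᵇ≡false⇒≥ lt₃) (subst (x <_) 4m≡ x<4m)

  decodes-below : ∀ j v pos → Decodes j pos v → v ≤ half j → Decodes (suc j) pos v
  decodes-below j v (s , r , c) (r<m , c<w , entry≡) v≤ = r<m , ≤-trans c<w (m≤m+n (width j) 2) ,
    trans (entry-old j s r c c<w) (trans (cong (shift j) entry≡) (shift-below j v≤))

  decodes-above : ∀ j u pos → Decodes j pos u → half j < u → Decodes (suc j) pos (u + 4 * m)
  decodes-above j u (s , r , c) (r<m , c<w , entry≡) M<u = r<m , ≤-trans c<w (m≤m+n (width j) 2) ,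
    trans (entry-old j s r c c<w) (trans (cong (shift j) entry≡) (shift-above j M<u))

  entry-decode : ∀ j v → 1 ≤ v → v ≤ size j → Decodes j (decode j v) v
  entry-decode zero (suc x) _ v≤ with baseDecode (suc x) | baseValue-baseDecode x (subst (x <_) (six m) v≤)
    where
    six : ∀ m → 2 * (m * 3) ≡ 6 * m
    six = solve-∀
  ... | (s , r , σ) | (r<m , value≡) =
    r<m , columnOf<3 s (arrangement r) σ , trans (cong (baseValue s r) (slotAt-columnOf s (arrangement r) σ)) value≡
  entry-decode (suc j) v 1≤v v≤ with v ≤ᵇ half j in le₁
  ... | true = decodes-below j v (decode j v)
                 (entry-decode j v 1≤v (≤-trans (≤ᵇ≡true⇒≤ le₁) (m≤m+n (half j) (half j + 0)))) (≤ᵇ≡true⇒≤ le₁)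
  ... | false with v ≤ᵇ half j + 4 * m in le₂
  ... | true = subst (Decodes (suc j) (decodeNew j (v ∸ suc (half j)))) v≡ (decodeNew-decodes j _ x<4m)
    where
    v≡ : suc (half j + (v ∸ suc (half j))) ≡ v
    v≡ = m+[n∸m]≡n (≤ᵇ≡false⇒> le₁)
    x<4m : v ∸ suc (half j) < 4 * m
    x<4m = +-cancelˡ-< (half j) _ _ (subst (_≤ half j + 4 * m) (sym v≡) (≤ᵇ≡true⇒≤ le₂))
  ... | false = subst (Decodes (suc j) (decode j u)) v≡
                  (decodes-above j u (decode j u) (entry-decode j u (≤-trans (s≤s z≤n) M<u) u≤) M<u)
    where
    u : ℕ
    u = v ∸ 4 * m
    M+4m<v : half j + 4 * m < v
    M+4m<v = ≤ᵇ≡false⇒> {v} {half j + 4 * m} le₂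
    v≡ : u + 4 * m ≡ v
    v≡ = m∸n+n≡m (≤-trans (m≤n+m (4 * m) (half j)) (<⇒≤ M+4m<v))
    M<u : half j < u
    M<u = +-cancelʳ-< (4 * m) (half j) u (subst (half j + 4 * m <_) (sym v≡) M+4m<v)
    size-suc : ∀ m W → 2 * (m * (W + 2)) ≡ 2 * (m * W) + 4 * m
    size-suc = solve-∀
    u≤ : u ≤ size j
    u≤ = +-cancelʳ-≤ (4 * m) u (size j) (subst₂ _≤_ (sym v≡) (size-suc m (width j)) v≤)

balancedArray : ∀ m j → 2 ≤ m → BalancedArray m (suc j) (2 * suc j + 1)
balancedArray m j 2≤m = subst (BalancedArray m (suc j)) (width≡2j+3 j) (record
  { entry            = entry j
  ; entry-bounds     = entry-bounds j
  ; entry-injective  = λ s r c s′ r′ c′ r<m c<w r′<m c′<w eq →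
      trans (sym (decode-entry j s r c r<m c<w)) (trans (cong (decode j) eq) (decode-entry j s′ r′ c′ r′<m c′<w))
  ; entry-surjective = λ v 1≤v v≤ → let (r<m , c<w , entry≡) = entry-decode j v 1≤v v≤ in
      proj₁ (decode j v) , proj₁ (proj₂ (decode j v)) , proj₂ (proj₂ (decode j v)) , r<m , c<w , entry≡
  ; row-sum          = row-sum j
  ; column-sum       = column-sum j
  })
  where
  arrangement : Σ (ℕ → Arrangement) λ a → BaseArray.ColumnsBalanced m a × BaseArray.ColumnsHalfAbove m a
  arrangement = balanced-arrangement m 2≤m
  open Extension m (proj₁ arrangement) (proj₁ (proj₂ arrangement)) (proj₂ (proj₂ arrangement))

module _ (G : Graph) (K : ℕ) where

  private
    p : ℕ
    p = order G

  inner : Fin p → Fin (order (joinEmpty G K))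
  inner u = u ↑ˡ K

  outer : Fin K → Fin (order (joinEmpty G K))
  outer o = p ↑ʳ o

  inner-edge : ∀ {u v} → Edge G u v → Edge (joinEmpty G K) (inner u) (inner v)
  inner-edge {u} {v} uv rewrite Fin.splitAt-↑ˡ p u K | Fin.splitAt-↑ˡ p v K = uv

  inner-outer-edge : ∀ u o → Edge (joinEmpty G K) (inner u) (outer o)
  inner-outer-edge u o rewrite Fin.splitAt-↑ˡ p u K | Fin.splitAt-↑ʳ p K o = refl

  fplus-join : ∀ (g : Fin (p + K) → Fin (p + K) → ℕ) x → fplus (joinEmpty G K) g x ≡
    sum (λ v → if adj (joinEmpty G K) x (inner v) then g x (inner v) else 0)
    + sum (λ o → if adj (joinEmpty G K) x (outer o) then g x (outer o) else 0)
  fplus-join g x = trans (ΣV≡sum (λ y → if adj (joinEmpty G K) x y then g x y else 0)) (sum-↑ p K _)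

distinct-values : ∀ L (ψ : Fin L → ℕ) → Σ ℕ λ s → s ≤ L × Σ (Fin s → ℕ) λ col →
  (∀ i j → col i ≡ col j → i ≡ j) × (∀ i → ∃[ k ] ψ i ≡ col k) × (∀ k → ∃[ i ] col k ≡ ψ i)
distinct-values zero ψ = 0 , z≤n , (λ ()) , (λ ()) , (λ ()) , (λ ())
distinct-values (suc L) ψ with distinct-values L (ψ ∘ suc)
... | s , s≤L , col , col-inj , covered , attained with Fin.any? (λ k → col k ≟ ψ zero)
...   | yes (k₀ , col≡) = s , ≤-trans s≤L (n≤1+n L) , col , col-inj , covered′ , attained′
  where
  covered′ : ∀ i → ∃[ k ] ψ i ≡ col k
  covered′ zero = k₀ , sym col≡
  covered′ (suc i) = covered i
  attained′ : ∀ k → ∃[ i ] col k ≡ ψ i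
  attained′ k = suc (proj₁ (attained k)) , proj₂ (attained k)
...   | no fresh = suc s , s≤s s≤L , col′ , col′-inj , covered′ , attained′
  where
  col′ : Fin (suc s) → ℕ
  col′ zero = ψ zero
  col′ (suc k) = col k
  col′-inj : ∀ i j → col′ i ≡ col′ j → i ≡ j
  col′-inj zero zero _ = refl
  col′-inj zero (suc k) eq = ⊥-elim (fresh (k , sym eq))
  col′-inj (suc k) zero eq = ⊥-elim (fresh (k , eq))
  col′-inj (suc i) (suc j) eq = cong suc (col-inj i j eq)
  covered′ : ∀ i → ∃[ k ] ψ i ≡ col′ k
  covered′ zero = zero , refl
  covered′ (suc i) = suc (proj₁ (covered i)) , proj₂ (covered i)
  attained′ : ∀ k → ∃[ i ] col′ k ≡ ψ i
  attained′ zero = zero , refl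
  attained′ (suc k) = suc (proj₁ (attained k)) , proj₂ (attained k)

numValues-≤ : ∀ {p} (c : Fin p → ℕ) L (ψ : Fin L → ℕ) →
  (∀ u → ∃[ i ] c u ≡ ψ i) → (∀ i → ∃[ u ] c u ≡ ψ i) → Σ ℕ λ s → s ≤ L × NumValues c s
numValues-≤ c L ψ c-in-ψ ψ-in-c with distinct-values L ψ
... | s , s≤L , col , col-inj , covered , attained = s , s≤L , col , col-inj ,
  (λ u → proj₁ (covered (proj₁ (c-in-ψ u))) , trans (proj₂ (c-in-ψ u)) (proj₂ (covered (proj₁ (c-in-ψ u))))) ,
  (λ k → proj₁ (ψ-in-c (proj₁ (attained k))) ,
         trans (proj₂ (ψ-in-c (proj₁ (attained k)))) (sym (proj₂ (attained k))))

-- An outer vertex is adjacent to all of G, so its colour is missing on G, whose colouring is proper.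
joinEmpty-χla≥ : ∀ (G : Graph) {K} t → Fin K → χ≡ G t → ∀ g s →
  IsLocalAntimagicColoring (joinEmpty G K) g s → suc t ≤ s
joinEmpty-χla≥ G {K} t o (_ , χ-minimal) g s ((_ , antimagic) , col , col-inj , covered , _) = go s col col-inj covered
  where
  o₀ : Fin (order (joinEmpty G K))
  o₀ = outer G K o
  go : ∀ s (col : Fin s → ℕ) → (∀ i j → col i ≡ col j → i ≡ j) →
       (∀ x → ∃[ i ] fplus (joinEmpty G K) g x ≡ col i) → suc t ≤ s
  go zero col _ covered with () ← proj₁ (covered o₀)
  go (suc s) col col-inj covered = s≤s (χ-minimal s colouring proper)
    where
    i₀ : Fin (suc s)
    i₀ = proj₁ (covered o₀)
    colourOf : Fin (order G) → Fin (suc s)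
    colourOf u = proj₁ (covered (inner G K u))
    i₀≢ : ∀ u → i₀ ≢ colourOf u
    i₀≢ u eq = antimagic (inner G K u) o₀ (inner-outer-edge G K u o)
      (trans (proj₂ (covered (inner G K u))) (trans (cong col (sym eq)) (sym (proj₂ (covered o₀)))))
    colouring : Fin (order G) → Fin s
    colouring u = punchOut (i₀≢ u)
    proper : ProperColoring G s colouring
    proper u v uv eq = antimagic (inner G K u) (inner G K v) (inner-edge G K uv)
      (trans (proj₂ (covered (inner G K u)))
        (trans (cong col (Fin.punchOut-injective (i₀≢ u) (i₀≢ v) eq)) (sym (proj₂ (covered (inner G K v))))))

χla≤∧χla≥⇒χla≡ : ∀ {H k} → χla≤ H k → (∀ g s → IsLocalAntimagicColoring H g s → k ≤ s) → χla≡ H k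
χla≤∧χla≥⇒χla≡ {H} (g , s , colouring , s≤k) minimal =
  g , subst (IsLocalAntimagicColoring H g) (≤-antisym s≤k (minimal g s colouring)) colouring , minimal

offset-by-one : ∀ {a b} X S → a + (X + (0 + S)) ≡ b + (X + (1 + S)) → a ≡ suc b
offset-by-one {a} {b} X S eq = +-cancelʳ-≡ (X + S) a (suc b) (trans eq (trans (cong (b +_) (+-suc X S)) (+-suc b (X + S))))

module JoinLabelling (G : Graph) (f : Fin (order G) → Fin (order G) → ℕ) (bij : IsEdgeBijection G f)
  (side : Fin (order G) → Bool) {m k K : ℕ}
  (count-side : count side ≡ m) (count-other : count (not ∘ side) ≡ m)
  (A : BalancedArray m k K) where

  open BalancedArray A

  private
    p : ℕ
    p = order G
    GK : Graph
    GK = joinEmpty G K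

  q : ℕ
  q = proj₁ (proj₂ bij)

  f-sym : ∀ u v → Edge G u v → f u v ≡ f v u
  f-sym = proj₁ bij

  f-bounds : ∀ u v → Edge G u v → (1 ≤ f u v) × (f u v ≤ q)
  f-bounds = proj₁ (proj₂ (proj₂ bij))

  f-surj : ∀ l → 1 ≤ l → l ≤ q → ∃[ u ] ∃[ v ] (Edge G u v × f u v ≡ l)
  f-surj = proj₁ (proj₂ (proj₂ (proj₂ bij)))

  f-inj : ∀ u v x y → Edge G u v → Edge G x y → f u v ≡ f x y → ((u ≡ x) × (v ≡ y)) ⊎ ((u ≡ y) × (v ≡ x))
  f-inj = proj₂ (proj₂ (proj₂ (proj₂ bij)))

  rankInSide : Fin p → ℕ
  rankInSide u = if side u then rank side u else rank (not ∘ side) u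

  rankInSide<m : ∀ u → rankInSide u < m
  rankInSide<m u with side u in su
  ... | true = subst (rank side u <_) count-side (rank<count side u su)
  ... | false = subst (rank (not ∘ side) u <_) count-other (rank<count (not ∘ side) u (cong not su))

  rankInSide-injective : ∀ u v → side u ≡ side v → rankInSide u ≡ rankInSide v → u ≡ v
  rankInSide-injective u v same eq with side u in su | side v in sv
  ... | true | true = rank-injective side u v su sv eq
  ... | false | false = rank-injective (not ∘ side) u v (cong not su) (cong not sv) eq

  rankInSide-surjective : ∀ s r → r < m → ∃[ u ] (side u ≡ s × rankInSide u ≡ r)
  rankInSide-surjective true r r<m with rank-surjective side r (subst (r <_) (sym count-side) r<m)
  ... | u , su , ru = u , su , trans (cong (λ b → if b then rank side u else rank (not ∘ side) u) su) ru
  rankInSide-surjective false r r<m with rank-surjective (not ∘ side) r (subst (r <_) (sym count-other) r<m)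
  ... | u , su , ru with side u in su′
  ...   | false = u , su′ , trans (cong (λ b → if b then rank side u else rank (not ∘ side) u) su′) ru

  weight : Fin p → Fin K → ℕ
  weight u o = entry (side u) (rankInSide u) (toℕ o)

  weight-injective : ∀ u o u′ o′ → weight u o ≡ weight u′ o′ → u ≡ u′ × o ≡ o′
  weight-injective u o u′ o′ eq
    with entry-injective _ _ _ _ _ _ (rankInSide<m u) (Fin.toℕ<n o) (rankInSide<m u′) (Fin.toℕ<n o′) eq
  ... | same = rankInSide-injective u u′ (,-injectiveˡ same) (,-injectiveˡ (,-injectiveʳ same)) ,
               Fin.toℕ-injective (,-injectiveʳ (,-injectiveʳ same))

  weight-bounds : ∀ u o → 1 ≤ weight u o × weight u o ≤ 2 * (m * K)
  weight-bounds u o = entry-bounds (side u) (rankInSide u) (toℕ o) (rankInSide<m u) (Fin.toℕ<n o)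

  label : Fin p ⊎ Fin K → Fin p ⊎ Fin K → ℕ
  label (inj₁ u) (inj₁ v) = f u v
  label (inj₁ u) (inj₂ o) = q + weight u o
  label (inj₂ o) (inj₁ u) = q + weight u o
  label (inj₂ _) (inj₂ _) = 0

  joinLabel : Fin (p + K) → Fin (p + K) → ℕ
  joinLabel x y = label (splitAt p x) (splitAt p y)

  private
    Adj : Fin p ⊎ Fin K → Fin p ⊎ Fin K → Set
    Adj a b = joinAdj (adj G) a b ≡ true

    label-sym : ∀ a b → Adj a b → label a b ≡ label b a
    label-sym (inj₁ u) (inj₁ v) uv = f-sym u v uv
    label-sym (inj₁ u) (inj₂ o) _ = refl
    label-sym (inj₂ o) (inj₁ u) _ = refl

    label-bounds : ∀ a b → Adj a b → 1 ≤ label a b × label a b ≤ q + 2 * (m * K)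
    label-bounds (inj₁ u) (inj₁ v) uv = proj₁ (f-bounds u v uv) , ≤-trans (proj₂ (f-bounds u v uv)) (m≤m+n q _)
    label-bounds (inj₁ u) (inj₂ o) _ = ≤-trans (proj₁ (weight-bounds u o)) (m≤n+m _ q) , +-monoʳ-≤ q (proj₂ (weight-bounds u o))
    label-bounds (inj₂ o) (inj₁ u) _ = ≤-trans (proj₁ (weight-bounds u o)) (m≤n+m _ q) , +-monoʳ-≤ q (proj₂ (weight-bounds u o))

    inner<join : ∀ u v o u′ → Edge G u v → f u v ≢ q + weight u′ o
    inner<join u v o u′ uv eq = <-irrefl eq (≤-<-trans (proj₂ (f-bounds u v uv))
      (subst (_≤ q + weight u′ o) (+-comm q 1) (+-monoʳ-≤ q (proj₁ (weight-bounds u′ o)))))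

    SameEdge : ∀ {A : Set} → A → A → A → A → Set
    SameEdge a b a′ b′ = (a ≡ a′ × b ≡ b′) ⊎ (a ≡ b′ × b ≡ a′)

    label-injective : ∀ a b a′ b′ → Adj a b → Adj a′ b′ → label a b ≡ label a′ b′ → SameEdge a b a′ b′
    label-injective (inj₁ u) (inj₁ v) (inj₁ u′) (inj₁ v′) uv u′v′ eq with f-inj u v u′ v′ uv u′v′ eq
    ... | inj₁ (refl , refl) = inj₁ (refl , refl)
    ... | inj₂ (refl , refl) = inj₂ (refl , refl)
    label-injective (inj₁ u) (inj₁ v) (inj₁ u′) (inj₂ o′) uv _ eq = ⊥-elim (inner<join u v o′ u′ uv eq)
    label-injective (inj₁ u) (inj₁ v) (inj₂ o′) (inj₁ u′) uv _ eq = ⊥-elim (inner<join u v o′ u′ uv eq)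
    label-injective (inj₁ u) (inj₂ o) (inj₁ u′) (inj₁ v′) _ u′v′ eq = ⊥-elim (inner<join u′ v′ o u u′v′ (sym eq))
    label-injective (inj₂ o) (inj₁ u) (inj₁ u′) (inj₁ v′) _ u′v′ eq = ⊥-elim (inner<join u′ v′ o u u′v′ (sym eq))
    label-injective (inj₁ u) (inj₂ o) (inj₁ u′) (inj₂ o′) _ _ eq with weight-injective u o u′ o′ (+-cancelˡ-≡ q _ _ eq)
    ... | refl , refl = inj₁ (refl , refl)
    label-injective (inj₁ u) (inj₂ o) (inj₂ o′) (inj₁ u′) _ _ eq with weight-injective u o u′ o′ (+-cancelˡ-≡ q _ _ eq)
    ... | refl , refl = inj₂ (refl , refl)
    label-injective (inj₂ o) (inj₁ u) (inj₁ u′) (inj₂ o′) _ _ eq with weight-injective u o u′ o′ (+-cancelˡ-≡ q _ _ eq)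
    ... | refl , refl = inj₂ (refl , refl)
    label-injective (inj₂ o) (inj₁ u) (inj₂ o′) (inj₁ u′) _ _ eq with weight-injective u o u′ o′ (+-cancelˡ-≡ q _ _ eq)
    ... | refl , refl = inj₁ (refl , refl)

    splitAt-injective : ∀ x y → splitAt p {K} x ≡ splitAt p y → x ≡ y
    splitAt-injective x y eq = trans (sym (Fin.join-splitAt p K x)) (trans (cong (join p K) eq) (Fin.join-splitAt p K y))

    sameEdge-splitAt : ∀ x y x′ y′ → SameEdge (splitAt p x) (splitAt p y) (splitAt p x′) (splitAt p y′) → SameEdge x y x′ y′
    sameEdge-splitAt x y x′ y′ (inj₁ (a , b)) = inj₁ (splitAt-injective x x′ a , splitAt-injective y y′ b)
    sameEdge-splitAt x y x′ y′ (inj₂ (a , b)) = inj₂ (splitAt-injective x y′ a , splitAt-injective y x′ b)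

    label-surjective : ∀ l → 1 ≤ l → l ≤ q + 2 * (m * K) → ∃[ x ] ∃[ y ] (Edge GK x y × joinLabel x y ≡ l)
    label-surjective l 1≤l l≤ with l ≤? q
    ... | yes l≤q with f-surj l 1≤l l≤q
    ...   | u , v , uv , fuv = inner G K u , inner G K v , inner-edge G K uv ,
            trans (cong₂ label (Fin.splitAt-↑ˡ p u K) (Fin.splitAt-↑ˡ p v K)) fuv
    label-surjective l 1≤l l≤ | no l≰q
      with entry-surjective (l ∸ q) (m<n⇒0<n∸m (≰⇒> l≰q)) (+-cancelˡ-≤ q _ _ (subst (_≤ q + 2 * (m * K)) (sym q+[l∸q]≡l) l≤))
      where
      q+[l∸q]≡l : q + (l ∸ q) ≡ l
      q+[l∸q]≡l = m+[n∸m]≡n (≤-trans (n≤1+n q) (≰⇒> l≰q))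
    ... | s , r , c , r<m , c<K , entry≡ with rankInSide-surjective s r r<m
    ...   | u , refl , refl = inner G K u , outer G K (fromℕ< c<K) , inner-outer-edge G K u (fromℕ< c<K) ,
            trans (cong₂ label (Fin.splitAt-↑ˡ p u K) (Fin.splitAt-↑ʳ p K (fromℕ< c<K)))
              (trans (cong (λ c → q + entry (side u) (rankInSide u) c) (Fin.toℕ-fromℕ< c<K))
                (trans (cong (q +_) entry≡) (m+[n∸m]≡n (≤-trans (n≤1+n q) (≰⇒> l≰q)))))

  joinLabel-bijection : IsEdgeBijection GK joinLabel
  joinLabel-bijection =
      (λ x y → label-sym (splitAt p x) (splitAt p y))
    , q + 2 * (m * K)
    , (λ x y → label-bounds (splitAt p x) (splitAt p y))
    , label-surjective
    , λ x y x′ y′ xy x′y′ eq → sameEdge-splitAt x y x′ y′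
        (label-injective (splitAt p x) (splitAt p y) (splitAt p x′) (splitAt p y′) xy x′y′ eq)

  innerColour : Fin p → ℕ
  innerColour u = fplus G f u + (K * q + (𝟙 (not (side u)) + rowSum m k K))

  outerColour : ℕ
  outerColour = p * q + columnSum m K

  fplus-inner : ∀ u → fplus GK joinLabel (inner G K u) ≡ innerColour u
  fplus-inner u = trans (fplus-join G K joinLabel (inner G K u)) (cong₂ _+_ from-inner from-outer)
    where
    open ≡-Reasoning
    from-inner : sum (λ v → if adj GK (inner G K u) (inner G K v) then joinLabel (inner G K u) (inner G K v) else 0)
                 ≡ fplus G f u
    from-inner = trans (sum-cong-≗ at) (sym (ΣV≡sum (λ v → if adj G u v then f u v else 0)))
      where
      at : ∀ v → (if adj GK (inner G K u) (inner G K v) then joinLabel (inner G K u) (inner G K v) else 0)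
                 ≡ (if adj G u v then f u v else 0)
      at v rewrite Fin.splitAt-↑ˡ p u K | Fin.splitAt-↑ˡ p v K = refl
    from-outer : sum (λ o → if adj GK (inner G K u) (outer G K o) then joinLabel (inner G K u) (outer G K o) else 0)
                 ≡ K * q + (𝟙 (not (side u)) + rowSum m k K)
    from-outer = begin
      sum (λ o → if adj GK (inner G K u) (outer G K o) then joinLabel (inner G K u) (outer G K o) else 0)
        ≡⟨ sum-cong-≗ at ⟩
      sum (λ o → q + weight u o)
        ≡⟨ ∑-distrib-+ {K} (λ _ → q) (weight u) ⟩
      sum {K} (λ _ → q) + sumBelow K (entry (side u) (rankInSide u))
        ≡⟨ cong₂ _+_ (sum-const {K} q) (row-sum (side u) (rankInSide u) (rankInSide<m u)) ⟩
      K * q + (𝟙 (not (side u)) + rowSum m k K) ∎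
      where
      at : ∀ o → (if adj GK (inner G K u) (outer G K o) then joinLabel (inner G K u) (outer G K o) else 0)
                 ≡ q + weight u o
      at o rewrite Fin.splitAt-↑ˡ p u K | Fin.splitAt-↑ʳ p K o = refl

  weight-column-sum : ∀ o → sum (λ v → weight v o) ≡ columnSum m K
  weight-column-sum o = begin
    sum (λ v → weight v o)
      ≡⟨ sum-cong-≗ by-side ⟩
    sum (λ v → (if side v then E true (rank side v) else 0) + (if not (side v) then E false (rank (not ∘ side) v) else 0))
      ≡⟨ ∑-distrib-+ (λ v → if side v then E true (rank side v) else 0) (λ v → if not (side v) then E false (rank (not ∘ side) v) else 0) ⟩
    sum (λ v → if side v then E true (rank side v) else 0) + sum (λ v → if not (side v) then E false (rank (not ∘ side) v) else 0)
      ≡⟨ cong₂ _+_ (sum-by-rank side (E true)) (sum-by-rank (not ∘ side) (E false)) ⟩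
    sumBelow (count side) (E true) + sumBelow (count (not ∘ side)) (E false)
      ≡⟨ cong₂ (λ a b → sumBelow a (E true) + sumBelow b (E false)) count-side count-other ⟩
    sumBelow m (E true) + sumBelow m (E false)
      ≡⟨ sym (sumBelow-+ m (E true) (E false)) ⟩
    sumBelow m (λ r → E true r + E false r)
      ≡⟨ column-sum (toℕ o) (Fin.toℕ<n o) ⟩
    columnSum m K ∎
    where
    open ≡-Reasoning
    E : Bool → ℕ → ℕ
    E s r = entry s r (toℕ o)
    by-side : ∀ v → weight v o ≡ (if side v then E true (rank side v) else 0) + (if not (side v) then E false (rank (not ∘ side) v) else 0)
    by-side v with side v
    ... | true = sym (+-identityʳ _)
    ... | false = refl

  fplus-outer : ∀ o → fplus GK joinLabel (outer G K o) ≡ outerColour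
  fplus-outer o = trans (fplus-join G K joinLabel (outer G K o)) (trans (cong₂ _+_ from-inner from-outer) (+-identityʳ _))
    where
    from-inner : sum (λ v → if adj GK (outer G K o) (inner G K v) then joinLabel (outer G K o) (inner G K v) else 0)
                 ≡ outerColour
    from-inner = trans (sum-cong-≗ at) (trans (∑-distrib-+ (λ _ → q) (λ v → weight v o))
                   (cong₂ _+_ (sum-const {p} q) (weight-column-sum o)))
      where
      at : ∀ v → (if adj GK (outer G K o) (inner G K v) then joinLabel (outer G K o) (inner G K v) else 0) ≡ q + weight v o
      at v rewrite Fin.splitAt-↑ʳ p K o | Fin.splitAt-↑ˡ p v K = refl
    from-outer : sum (λ o′ → if adj GK (outer G K o) (outer G K o′) then joinLabel (outer G K o) (outer G K o′) else 0) ≡ 0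
    from-outer = trans (sum-cong-≗ at) (trans (sum-const {K} 0) (*-zeroʳ K))
      where
      at : ∀ o′ → (if adj GK (outer G K o) (outer G K o′) then joinLabel (outer G K o) (outer G K o′) else 0) ≡ 0
      at o′ rewrite Fin.splitAt-↑ʳ p K o | Fin.splitAt-↑ʳ p K o′ = refl

  innerColour-≢ : (∀ u v → Edge G u v → fplus G f u ≢ fplus G f v) →
    (∀ u v → side u ≡ true → side v ≡ false → fplus G f u ≢ suc (fplus G f v)) →
    ∀ u v → Edge G u v → innerColour u ≢ innerColour v
  innerColour-≢ antimagic no-rise u v uv eq with side u in su | side v in sv
  ... | true | true = antimagic u v uv (+-cancelʳ-≡ _ _ _ eq)
  ... | false | false = antimagic u v uv (+-cancelʳ-≡ _ _ _ eq)
  ... | true | false = no-rise u v su sv (offset-by-one (K * q) (rowSum m k K) eq)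
  ... | false | true = no-rise v u sv su (offset-by-one (K * q) (rowSum m k K) (sym eq))

  joinLabel-antimagic : (∀ u v → Edge G u v → fplus G f u ≢ fplus G f v) →
    (∀ u v → side u ≡ true → side v ≡ false → fplus G f u ≢ suc (fplus G f v)) →
    (∀ u → innerColour u ≢ outerColour) →
    ∀ x y → Edge GK x y → fplus GK joinLabel x ≢ fplus GK joinLabel y
  joinLabel-antimagic antimagic no-rise separated x y = by-parts (splitAt p x) (splitAt p y) refl refl
    where
    colour-inner : ∀ {x u} → splitAt p x ≡ inj₁ u → fplus GK joinLabel x ≡ innerColour u
    colour-inner {x} {u} eq = trans (cong (fplus GK joinLabel) (sym (Fin.splitAt⁻¹-↑ˡ eq))) (fplus-inner u)
    colour-outer : ∀ {x o} → splitAt p x ≡ inj₂ o → fplus GK joinLabel x ≡ outerColour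
    colour-outer {x} {o} eq = trans (cong (fplus GK joinLabel) (sym (Fin.splitAt⁻¹-↑ʳ eq))) (fplus-outer o)
    by-parts : ∀ a b → splitAt p x ≡ a → splitAt p y ≡ b → joinAdj (adj G) a b ≡ true →
               fplus GK joinLabel x ≢ fplus GK joinLabel y
    by-parts (inj₁ u) (inj₁ v) x≡ y≡ uv eq =
      innerColour-≢ antimagic no-rise u v uv (trans (sym (colour-inner x≡)) (trans eq (colour-inner y≡)))
    by-parts (inj₁ u) (inj₂ o) x≡ y≡ _ eq = separated u (trans (sym (colour-inner x≡)) (trans eq (colour-outer y≡)))
    by-parts (inj₂ o) (inj₁ v) x≡ y≡ _ eq = separated v (trans (sym (colour-inner y≡)) (trans (sym eq) (colour-outer x≡)))

  -- The new colours are the outer one and one per colour of G, side being constant on colour classes.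
  joinLabel-numValues : ∀ {t} → NumValues (fplus G f) t → (∀ u v → fplus G f u ≡ fplus G f v → side u ≡ side v) →
    Fin K → Σ ℕ λ s → s ≤ suc t × NumValues (fplus GK joinLabel) s
  joinLabel-numValues {t} (col , _ , covered , attained) side-constant o₀ = numValues-≤ (fplus GK joinLabel) (suc t) ψ ψ-covers ψ-attained
    where
    rep : Fin t → Fin p
    rep i = proj₁ (attained i)
    ψ : Fin (suc t) → ℕ
    ψ zero = outerColour
    ψ (suc i) = innerColour (rep i)
    ψ-covers : ∀ x → ∃[ i ] fplus GK joinLabel x ≡ ψ i
    ψ-covers x = by-part (splitAt p x) refl
      where
      by-part : ∀ a → splitAt p x ≡ a → ∃[ i ] fplus GK joinLabel x ≡ ψ i
      by-part (inj₁ u) x≡ = suc i , trans (cong (fplus GK joinLabel) (sym (Fin.splitAt⁻¹-↑ˡ x≡)))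
          (trans (fplus-inner u) (cong₂ (λ a b → a + (K * q + (𝟙 (not b) + rowSum m k K))) same-colour
                                        (side-constant u (rep i) same-colour)))
        where
        i : Fin t
        i = proj₁ (covered u)
        same-colour : fplus G f u ≡ fplus G f (rep i)
        same-colour = trans (proj₂ (covered u)) (sym (proj₂ (attained i)))
      by-part (inj₂ o) x≡ = zero , trans (cong (fplus GK joinLabel) (sym (Fin.splitAt⁻¹-↑ʳ x≡))) (fplus-outer o)
    ψ-attained : ∀ i → ∃[ x ] fplus GK joinLabel x ≡ ψ i
    ψ-attained zero = outer G K o₀ , fplus-outer o₀
    ψ-attained (suc i) = inner G K (rep i) , fplus-inner (rep i)

NoRise : ∀ {p} → (Fin p → ℕ) → (Fin p → Bool) → Set
NoRise c side = ∀ u v → side u ≡ true → side v ≡ false → c u ≢ suc (c v)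

-- A rise u ↦ v + 1 from the true side to the false side, together with a rise from the false
-- side to the true side, would be exactly the forbidden configuration.
noRise-or-flipped : ∀ {p} (c : Fin p → ℕ) (side : Fin p → Bool) →
  ¬ (∃[ a ] ∃[ b ] ∃[ u₁ ] ∃[ u₂ ] ∃[ w₁ ] ∃[ w₂ ]
       (side u₁ ≡ true × c u₁ ≡ a × side u₂ ≡ true × c u₂ ≡ suc b
      × side w₁ ≡ false × c w₁ ≡ suc a × side w₂ ≡ false × c w₂ ≡ b)) →
  NoRise c side ⊎ NoRise c (not ∘ side)
noRise-or-flipped c side forbidden
  with Fin.any? (λ u → Fin.any? (λ v → (side u Bool.≟ true) ×-dec ((side v Bool.≟ false) ×-dec (c u ≟ suc (c v)))))
... | no no-rise = inj₁ λ u v su sv rise → no-rise (u , v , su , sv , rise)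
... | yes (u′ , v′ , su′ , sv′ , rise′) = inj₂ λ u v su sv rise →
  forbidden (c v , c v′ , v , u′ , u , v′ , not-false sv , refl , su′ , rise′ , not-true su , rise , sv′ , refl)
  where
  not-true : ∀ {b} → not b ≡ true → b ≡ false
  not-true {false} _ = refl
  not-false : ∀ {b} → not b ≡ false → b ≡ true
  not-false {true} _ = refl

join-colouring : ∀ m j t → 2 ≤ m → (G : Graph) → order G ≡ 2 * m →
  (f : Fin (order G) → Fin (order G) → ℕ) → IsLocalAntimagicColoring G f t →
  (side : Fin (order G) → Bool) → (∀ u v → fplus G f u ≡ fplus G f v → side u ≡ side v) →
  count side ≡ m → count (not ∘ side) ≡ m → NoRise (fplus G f) side →
  2 * m < 2 * suc j + 1 ⊎ LargeOrder m (suc (suc j)) →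
  χla≤ (joinEmpty G (2 * suc j + 1)) (suc t)
join-colouring m j t 2≤m G order≡ f ((bij , antimagic) , values) side side-constant count₁ count₂ no-rise condition =
  let (s , s≤ , values′) = joinLabel-numValues values side-constant zero in
  joinLabel , s , ((joinLabel-bijection , joinLabel-antimagic antimagic no-rise separated) , values′) , s≤
  where
  open JoinLabelling G f bij side count₁ count₂ (balancedArray m j 2≤m)
  e≤1 : ∀ b → 𝟙 (not b) ≤ 1
  e≤1 true = z≤n
  e≤1 false = s≤s z≤n
  separated : ∀ u → innerColour u ≢ outerColour
  separated u = by-condition condition
    where
    by-condition : 2 * m < 2 * suc j + 1 ⊎ LargeOrder m (suc (suc j)) → innerColour u ≢ outerColour
    by-condition (inj₁ 2m<K) = λ eq → <-irrefl (sym eq) (subst (λ p → p * q + _ < innerColour u) (sym order≡)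
          (outerColour<innerColour m j q (fplus G f u) (𝟙 (not (side u))) (≤-trans (s≤s z≤n) 2≤m) 2m<K))
    by-condition (inj₂ large) = λ eq → <-irrefl eq (subst (λ p → innerColour u < p * q + _) (sym order≡)
          (innerColour<outerColour m j q (degree G u) (fplus G f u) (𝟙 (not (side u))) (e≤1 (side u))
            (fplus+tri≤ G f f-bounds f-inj u)
            (subst (degree G u <_) order≡ (degree<order G u))
            (subst (λ p → q ≤ tri p) order≡ (labels≤tri G f f-sym f-surj))
            large))

2*suc∸1 : ∀ k → 2 * suc k ∸ 1 ≡ 2 * k + 1
2*suc∸1 k = cong (_∸ 1) (expand k)
  where
  expand : ∀ k → 2 * suc k ≡ suc (2 * k + 1)
  expand = solve-∀

theorem3p12 : (m n t : ℕ) → 2 ≤ m → 2 ≤ n → 3 ≤ t →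
    (G : Graph) → order G ≡ 2 * m →
    (f : Fin (order G) → Fin (order G) → ℕ) → IsLocalAntimagicColoring G f t →
    (∃[ side ] ((∀ u v → fplus G f u ≡ fplus G f v → side u ≡ side v)
      × countV side ≡ m
      × countV (λ u → not (side u)) ≡ m
      × ¬ (∃[ a ] ∃[ b ] ∃[ u₁ ] ∃[ u₂ ] ∃[ w₁ ] ∃[ w₂ ]
             (side u₁ ≡ true × fplus G f u₁ ≡ a
            × side u₂ ≡ true × fplus G f u₂ ≡ suc b
            × side w₁ ≡ false × fplus G f w₁ ≡ suc a
            × side w₂ ≡ false × fplus G f w₂ ≡ b)))) →
    (2 * m < 2 * n ∸ 1 ⊎ 2 * (n * n) ≤ 2 * m + 3 * (n ∸ 1)) →
    χla≤ (joinEmpty G (2 * n ∸ 1)) (suc t)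
    × (χ≡ G t → χla≡ (joinEmpty G (2 * n ∸ 1)) (suc t))
theorem3p12 m 1 t _ (s≤s ()) _ G _ f _ _ _
theorem3p12 m (suc (suc j)) t 2≤m _ _ G order≡ f colouring (side , side-constant , count₁ , count₂ , forbidden) condition
  rewrite 2*suc∸1 (suc j) = upper , λ χ≡t → χla≤∧χla≥⇒χla≡ {joinEmpty G (2 * suc j + 1)} upper (joinEmpty-χla≥ G t zero χ≡t)
  where
  count-side : count side ≡ m
  count-side = trans (sym (countV≡count side)) count₁
  count-other : count (not ∘ side) ≡ m
  count-other = trans (sym (countV≡count (not ∘ side))) count₂
  count-not-other : count (not ∘ (not ∘ side)) ≡ m
  count-not-other = trans (sum-cong-≗ (λ u → cong 𝟙 (not-involutive (side u)))) count-side
  upper : χla≤ (joinEmpty G (2 * suc j + 1)) (suc t)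
  upper with noRise-or-flipped (fplus G f) side forbidden
  ... | inj₁ no-rise = join-colouring m j t 2≤m G order≡ f colouring side side-constant
                         count-side count-other no-rise condition
  ... | inj₂ no-rise = join-colouring m j t 2≤m G order≡ f colouring (not ∘ side)
                         (λ u v same → cong not (side-constant u v same)) count-other count-not-other no-rise condition
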